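{- Let $n\geq 6$ be even and let $d_*$ be the extended difference row of a normal cyclic Latin row of length $n$ with maximum inner distance. Then $d_*$ is a rotation (cyclic shift) of \[(\underbrace{1,\dots,1}_{\frac n2-1},0,\underbrace{ -1,\dots,-1}_{\frac n2-1},0),\] or $d_*=\pm(1,1,\dots,1)$. If $n\equiv 0\pmod 4$ there are exactly $n+2$ normal cyclic Latin rows of length $n$ with maximum inner distance, and if $n\equiv 2\pmod 4$ there are exactly $n$.
   Context: For $a,b\in[1,n]$, $\mathrm{dist}(a,b)$ is the minimum of the residues in $[0,n-1]$ of $a-b$ and $b-a$ modulo $n$. A Latin row of length $n$ is a permutation $(s_1,\dots,s_n)$ of $[1,n]$; it is normal if $s_1=1$; it has maximum inner distance if $\mathrm{dist}(s_j,s_{j+1})\ge \frac n2-1$ for all $1\le j\le n-1$; such a row is cyclic if in addition $\mathrm{dist}(s_n,s_1)\ge\frac n2-1$ (i.e. it corresponds to a Hamiltonian cycle in the graph on $[1,n]$ joining symbols at distance at least $\frac n2-1$). Let $h_j\in[0,n-1]$ with $h_j\equiv s_{j+1}-s_j \pmod n$ for $1\le j\le n-1$ and $h_n\in[0,n-1]$ with $h_n\equiv s_1-s_n\pmod n$. The extended difference row is the integer vector $d_*=(\epsilon_1,\dots,\epsilon_{n-1},h)$ with $\epsilon_j=h_j-\frac n2$ and $h=h_n-\frac n2$ (not reduced mod $n$); it has $n$ entries. A rotation of an $n$-vector is a cyclic shift of its entries. -}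

module Defs where

open import Data.Nat using (ℕ; zero; suc; _+_; _∸_; _≤_; _≤ᵇ_; _⊓_; _/_)
open import Data.Nat.Divisibility using (_∣_)
open import Data.Integer as ℤ using (ℤ)
open import Data.Fin using (Fin; toℕ; zero)
open import Data.Vec using (Vec; toList)
open import Data.List using (List; []; _∷_; _++_; [_]; zip; map; head; replicate; drop; take; length; allFin)
open import Data.List.Relation.Unary.Linked using (Linked)
open import Data.List.Relation.Binary.Permutation.Propositional using (_↭_)
open import Data.List.Relation.Unary.Unique.Propositional using (Unique)
open import Data.List.Membership.Propositional using (_∈_)
open import Data.Product using (_×_; Σ; ∃)
open import Data.Sum using (_⊎_)
open import Data.Bool using (if_then_else_)
open import Data.Unit using (⊤)
open import Data.Maybe using (just)
open import Relation.Binary.PropositionalEquality using (_≡_)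

-- Symbols [1,n] are encoded as Fin n: the element i : Fin n stands for symbol (toℕ i + 1).
-- Differences are shift invariant, so this does not affect distances or difference rows.

resDiff : (n : ℕ) → ℕ → ℕ → ℕ
resDiff n a b = if b ≤ᵇ a then a ∸ b else (n + a) ∸ b

dist : (n : ℕ) → Fin n → Fin n → ℕ
dist n a b = resDiff n (toℕ a) (toℕ b) ⊓ resDiff n (toℕ b) (toℕ a)

FarApart : (n : ℕ) → Fin n → Fin n → Set
FarApart n a b = (n / 2) ∸ 1 ≤ dist n a b

LatinRow : (n : ℕ) → Vec (Fin n) n → Set
LatinRow n s = toList s ↭ allFin n

-- normal: s_1 = 1 (encoded as Fin zero)
Normal : (n : ℕ) → Vec (Fin n) n → Set
Normal n s = head (map toℕ (toList s)) ≡ just 0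

cyclicPairs : {A : Set} → List A → List (A × A)
cyclicPairs [] = []
cyclicPairs (x ∷ xs) = zip (x ∷ xs) (xs ++ [ x ])

MaxInnerDistance : (n : ℕ) → Vec (Fin n) n → Set
MaxInnerDistance n s = Linked (FarApart n) (toList s)

CyclicClosing : {A : Set} → (A → A → Set) → List A → Set
CyclicClosing R [] = ⊤
CyclicClosing R (x ∷ xs) = Linked R ((x ∷ xs) ++ [ x ])

NormalCyclicMaxRow : (n : ℕ) → Vec (Fin n) n → Set
NormalCyclicMaxRow n s =
  LatinRow n s × Normal n s × MaxInnerDistance n s × CyclicClosing (FarApart n) (toList s)

-- extended difference row: entries h_j - n/2 where h_j is the residue of s_{j+1} - s_j
-- (indices cyclic, the last entry being h = h_n - n/2), as integers (not reduced)
extDiffRow : (n : ℕ) → Vec (Fin n) n → List ℤ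
extDiffRow n s =
  map (λ p → ℤ.+ (resDiff n (toℕ (Data.Product.proj₂ p)) (toℕ (Data.Product.proj₁ p))) ℤ.- ℤ.+ (n / 2))
      (cyclicPairs (toList s))
  where import Data.Product

IsRotationOf : {A : Set} → List A → List A → Set
IsRotationOf xs ys = ∃ λ k → xs ≡ drop k ys ++ take k ys

pattern₀ : ℕ → List ℤ
pattern₀ n = replicate ((n / 2) ∸ 1) (ℤ.+ 1) ++ [ ℤ.+ 0 ] ++ replicate ((n / 2) ∸ 1) (ℤ.- ℤ.+ 1) ++ [ ℤ.+ 0 ]

HasExactlyRows : (n k : ℕ) → Set
HasExactlyRows n k =
  Σ (List (Vec (Fin n) n)) λ L →
    Unique L × length L ≡ k ×
    ((s : Vec (Fin n) n) → (NormalCyclicMaxRow n s → s ∈ L) × (s ∈ L → NormalCyclicMaxRow n s))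

-- Read a row periodically as F : ℕ → ℕ (F j is the symbol at position j mod n, counted from 0)
-- and let h j = F (j + 1) − F j mod n be its steps.  With n = 2m, maximum inner distance means
-- exactly h j ∈ {m − 1, m, m + 1}.  Two consecutive steps cannot add up to n, since F would
-- repeat a value.  A step m flanked by m + 1 and m − 1 forces the whole period: on every
-- symmetric window around it F rises by exactly m, so a further m would make F repeat, and
-- the window grows until the period is (m + 1)^(m − 1) m (m − 1)^(m − 1) m up to rotation.
-- A step m that is not flanked that way starts a run of steps of one sign, whose sum over a
-- period cannot be ≡ 0 mod n; and without any step m the steps are constant.  Conversely each
-- of the n rotations is realised by an explicit row, and the constant steps m ± 1 by
-- j ↦ j (m ± 1) mod n, which is injective exactly when m is even, i.e. when 4 ∣ n.  Since the
-- steps determine a normal row, this counts the rows.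

module Submission where

open import Defs
open import Data.Nat using (ℕ; _≤_; _+_)
open import Data.Nat.Divisibility using (_∣_)
open import Data.Integer as ℤ using (ℤ)
open import Data.Fin using (Fin)
open import Data.Vec using (Vec)
open import Data.List using (replicate)
open import Data.Product using (_×_)
open import Data.Sum using (_⊎_)
open import Relation.Nullary using (¬_)
open import Relation.Binary.PropositionalEquality using (_≡_)

open import Data.Nat
open import Data.Nat.Properties
open import Data.Nat.DivMod
open import Data.Nat.Divisibility using (divides)
open import Data.Nat.Tactic.RingSolver using (solve-∀)
open import Data.Bool using (true; false; T)
open import Data.Parity.Base using (Parity; 0ℙ; 1ℙ) renaming (_+_ to _+ℙ_)
import Data.Parity.Properties as ℙ
import Data.Integer.Properties as ℤP
open import Data.Unit using (tt)
open import Data.Empty using (⊥; ⊥-elim)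
open import Data.Product using (_,_; proj₁; proj₂; ∃)
open import Data.Sum using (inj₁; inj₂)
open import Data.Maybe using (just)
open import Data.Maybe.Properties using (just-injective)
open import Data.Fin using (toℕ; fromℕ<; punchOut)
open import Data.Fin.Patterns using (0F)
open import Data.Fin.Properties using (any?; punchOut-injective; injective⇒≤; toℕ<n; toℕ-fromℕ<; toℕ-injective)
import Data.Fin.Properties as Fin
open import Data.Vec using (toList) renaming ([] to []ᵥ; _∷_ to _∷ᵥ_)
open import Data.List using (List; []; _∷_; _++_; [_]; _∷ʳ_; map; head; zip; drop; take; length; applyUpTo; allFin)
open import Data.List.Properties using (applyUpTo-∷ʳ; map-applyUpTo; length-applyUpTo; length-++)
open import Data.List.Membership.Propositional using (_∈_)
open import Data.List.Membership.Propositional.Properties using (∈-allFin; ∈-applyUpTo⁺; ∈-applyUpTo⁻; ∈-++⁺ˡ; ∈-++⁺ʳ; ∈-++⁻)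
open import Data.List.Relation.Unary.Any using (here; there)
open import Data.List.Membership.Propositional.Properties.WithK using (unique∧set⇒bag)
open import Data.List.Relation.Binary.BagAndSetEquality using (∼bag⇒↭)
open import Data.List.Relation.Binary.Permutation.Propositional using (_↭_; ↭-sym; ↭⇒↭ₛ)
import Data.List.Relation.Binary.Permutation.Setoid.Properties as PermutationProperties
open import Data.List.Relation.Unary.All using (All; []; _∷_)
open import Data.List.Relation.Unary.AllPairs using ([]; _∷_)
open import Data.List.Relation.Unary.Linked using (Linked; _∷_)
import Data.List.Relation.Unary.Linked.Properties as Linked
open import Data.List.Relation.Unary.Unique.Propositional using (Unique)
import Data.List.Relation.Unary.Unique.Propositional.Properties as Unique
open import Function.Base using (id; _∘_)
open import Function.Bundles using (_⇔_; mk⇔; Equivalence)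
open import Function.Definitions using (Injective)
open import Relation.Nullary using (Dec; yes; no; contradiction)
open import Relation.Nullary.Decidable using (_×-dec_)
open import Relation.Binary.Bundles using (Setoid)
open import Relation.Binary.Definitions using (tri<; tri≈; tri>)
open import Relation.Binary.PropositionalEquality
  using (_≢_; refl; sym; trans; cong; cong₂; subst; subst₂; setoid; module ≡-Reasoning)
import Relation.Binary.Reasoning.Setoid as SetoidReasoning

private
  variable
    A B : Set

applyUpTo-cong : ∀ {f g : ℕ → A} t → (∀ {j} → j < t → f j ≡ g j) → applyUpTo f t ≡ applyUpTo g t
applyUpTo-cong zero f≗g = refl
applyUpTo-cong (suc t) f≗g = cong₂ _∷_ (f≗g z<s) (applyUpTo-cong t (λ j<t → f≗g (s<s j<t)))

applyUpTo-++ : ∀ (f : ℕ → A) a b → applyUpTo f (a + b) ≡ applyUpTo f a ++ applyUpTo (λ j → f (a + j)) b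
applyUpTo-++ f zero b = refl
applyUpTo-++ f (suc a) b = cong (f 0 ∷_) (applyUpTo-++ (λ j → f (suc j)) a b)

drop-applyUpTo : ∀ (f : ℕ → A) a b → drop a (applyUpTo f (a + b)) ≡ applyUpTo (λ j → f (a + j)) b
drop-applyUpTo f zero b = refl
drop-applyUpTo f (suc a) b = drop-applyUpTo (λ j → f (suc j)) a b

take-applyUpTo : ∀ (f : ℕ → A) a b → take a (applyUpTo f (a + b)) ≡ applyUpTo f a
take-applyUpTo f zero b = refl
take-applyUpTo f (suc a) b = cong (f 0 ∷_) (take-applyUpTo (λ j → f (suc j)) a b)

zip-applyUpTo : ∀ (f : ℕ → A) (g : ℕ → B) t → zip (applyUpTo f t) (applyUpTo g t) ≡ applyUpTo (λ j → f j , g j) t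
zip-applyUpTo f g zero = refl
zip-applyUpTo f g (suc t) = cong ((f 0 , g 0) ∷_) (zip-applyUpTo _ _ t)

replicate-applyUpTo : ∀ (x : A) t → replicate t x ≡ applyUpTo (λ _ → x) t
replicate-applyUpTo x zero = refl
replicate-applyUpTo x (suc t) = cong (x ∷_) (replicate-applyUpTo x t)

Unique-applyUpTo⁻ : ∀ (f : ℕ → A) {t} → Unique (applyUpTo f t) → ∀ {i j} → i < j → j < t → f i ≢ f j
Unique-applyUpTo⁻ f {suc t} (f0∉ ∷ _) {zero} {suc j} _ (s<s j<t) = All-lookup f0∉ j<t
  where
    All-lookup : ∀ {x} {g : ℕ → A} {u} → All (x ≢_) (applyUpTo g u) → ∀ {j} → j < u → x ≢ g j
    All-lookup {u = suc u} (p ∷ _) {zero} _ = p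
    All-lookup {u = suc u} (_ ∷ ps) {suc j} (s<s j<u) = All-lookup ps j<u
Unique-applyUpTo⁻ f {suc t} (_ ∷ u) {suc i} {suc j} (s<s i<j) (s<s j<t) =
  Unique-applyUpTo⁻ (λ j → f (suc j)) u i<j j<t

Linked-applyUpTo⁻ : ∀ {R : A → A → Set} (f : ℕ → A) {t} → Linked R (applyUpTo f t) →
                    ∀ {j} → suc j < t → R (f j) (f (suc j))
Linked-applyUpTo⁻ f {suc zero} _ {zero} (s<s ())
Linked-applyUpTo⁻ f {suc (suc t)} (r ∷ _) {zero} _ = r
Linked-applyUpTo⁻ f {suc (suc t)} (_ ∷ l) {suc j} (s<s j<t) = Linked-applyUpTo⁻ (λ j → f (suc j)) l j<t

lookupOr : ∀ {t} → Vec A t → A → ℕ → A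
lookupOr []ᵥ d j = d
lookupOr (x ∷ᵥ xs) d zero = x
lookupOr (x ∷ᵥ xs) d (suc j) = lookupOr xs d j

tabulateℕ : (ℕ → A) → (t : ℕ) → Vec A t
tabulateℕ f zero = []ᵥ
tabulateℕ f (suc t) = f 0 ∷ᵥ tabulateℕ (λ j → f (suc j)) t

toList-lookupOr : ∀ {t} (s : Vec A t) d → toList s ≡ applyUpTo (lookupOr s d) t
toList-lookupOr []ᵥ d = refl
toList-lookupOr (x ∷ᵥ s) d = cong (x ∷_) (toList-lookupOr s d)

toList-tabulateℕ : ∀ (f : ℕ → A) t → toList (tabulateℕ f t) ≡ applyUpTo f t
toList-tabulateℕ f zero = refl
toList-tabulateℕ f (suc t) = cong (f 0 ∷_) (toList-tabulateℕ _ t)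

lookupOr-tabulateℕ : ∀ (f : ℕ → A) {t} d {j} → j < t → lookupOr (tabulateℕ f t) d j ≡ f j
lookupOr-tabulateℕ f {suc t} d {zero} _ = refl
lookupOr-tabulateℕ f {suc t} d {suc j} (s<s j<t) = lookupOr-tabulateℕ (λ j → f (suc j)) d j<t

lookupOr-ext : ∀ {t} (s s′ : Vec A t) d → (∀ {j} → j < t → lookupOr s d j ≡ lookupOr s′ d j) → s ≡ s′
lookupOr-ext []ᵥ []ᵥ d _ = refl
lookupOr-ext (x ∷ᵥ s) (x′ ∷ᵥ s′) d eq = cong₂ _∷ᵥ_ (eq z<s) (lookupOr-ext s s′ d (λ j<t → eq (s<s j<t)))

-- Residues modulo n

module Congruence (n : ℕ) .{{_ : NonZero n}} where

  -- A record rather than a definition, so that x and y can be inferred from x ≈ y.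
  infix 4 _≈_
  record _≈_ (x y : ℕ) : Set where
    constructor mk≈
    field get : x % n ≡ y % n

  ≈-refl : ∀ {x} → x ≈ x
  ≈-refl = mk≈ refl

  ≈-sym : ∀ {x y} → x ≈ y → y ≈ x
  ≈-sym (mk≈ e) = mk≈ (sym e)

  ≈-trans : ∀ {x y z} → x ≈ y → y ≈ z → x ≈ z
  ≈-trans (mk≈ e) (mk≈ f) = mk≈ (trans e f)

  ≡⇒≈ : ∀ {x y} → x ≡ y → x ≈ y
  ≡⇒≈ refl = ≈-refl

  ≈-setoid : Setoid _ _
  ≈-setoid = record
    { Carrier = ℕ ; _≈_ = _≈_
    ; isEquivalence = record { refl = ≈-refl ; sym = ≈-sym ; trans = ≈-trans } }

  module ≈-Reasoning = SetoidReasoning ≈-setoid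

  +-cong-≈ : ∀ {a b c d} → a ≈ b → c ≈ d → a + c ≈ b + d
  +-cong-≈ {a} {b} {c} {d} (mk≈ p) (mk≈ q) = mk≈ (begin
      (a + c) % n          ≡⟨ %-distribˡ-+ a c n ⟩
      (a % n + c % n) % n  ≡⟨ cong₂ (λ x y → (x + y) % n) p q ⟩
      (b % n + d % n) % n  ≡⟨ %-distribˡ-+ b d n ⟨
      (b + d) % n          ∎)
    where open ≡-Reasoning

  +-congˡ-≈ : ∀ a {c d} → c ≈ d → a + c ≈ a + d
  +-congˡ-≈ a = +-cong-≈ (≈-refl {a})

  +-congʳ-≈ : ∀ c {a b} → a ≈ b → a + c ≈ b + c
  +-congʳ-≈ c e = +-cong-≈ e (≈-refl {c})

  %-≈ : ∀ x → x % n ≈ x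
  %-≈ x = mk≈ (m%n%n≡m%n x n)

  +n≈ : ∀ x → x + n ≈ x
  +n≈ x = mk≈ ([m+n]%n≡m%n x n)

  n≈0 : n ≈ 0
  n≈0 = +n≈ 0

  ≈⇒≡ : ∀ {x y} → x < n → y < n → x ≈ y → x ≡ y
  ≈⇒≡ {x} {y} x<n y<n (mk≈ e) = trans (sym (m<n⇒m%n≡m x<n)) (trans e (m<n⇒m%n≡m y<n))

  +-cancelˡ-≈ : ∀ a {b c} → a + b ≈ a + c → b ≈ c
  +-cancelˡ-≈ a {b} {c} e = begin
      b              ≈⟨ inverse+ b ⟨
      t + (a + b)    ≈⟨ +-congˡ-≈ t e ⟩
      t + (a + c)    ≈⟨ inverse+ c ⟩
      c              ∎
    where
      open ≈-Reasoning
      t = n ∸ a % n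
      inverse+ : ∀ x → t + (a + x) ≈ x
      inverse+ x = begin
        t + (a + x)        ≡⟨ +-assoc t a x ⟨
        t + a + x          ≈⟨ +-congʳ-≈ x (+-congˡ-≈ t (%-≈ a)) ⟨
        t + a % n + x      ≡⟨ cong (_+ x) (m∸n+n≡m (<⇒≤ (m%n<n a n))) ⟩
        n + x              ≈⟨ +-congʳ-≈ x n≈0 ⟩
        x                  ∎

  +-cancelʳ-≈ : ∀ c {a b} → a + c ≈ b + c → a ≈ b
  +-cancelʳ-≈ c {a} {b} e = +-cancelˡ-≈ c (≈-trans (≡⇒≈ (+-comm c a)) (≈-trans e (≡⇒≈ (+-comm b c))))

  ≉-within-period : ∀ {x y} → x < y → y < x + n → ¬ (x ≈ y)
  ≉-within-period {x} {y} x<y y<x+n e = <⇒≢ 0<d (≈⇒≡ 0<n d<n (+-cancelˡ-≈ x x+0≈x+d))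
    where
      d = y ∸ x
      x+d≡y : x + d ≡ y
      x+d≡y = m+[n∸m]≡n (<⇒≤ x<y)
      0<d : 0 < d
      0<d = m<n⇒0<n∸m x<y
      0<n : 0 < n
      0<n = >-nonZero⁻¹ n
      d<n : d < n
      d<n = +-cancelˡ-< x d n (subst (_< x + n) (sym x+d≡y) y<x+n)
      x+0≈x+d : x + 0 ≈ x + d
      x+0≈x+d = ≈-trans (≡⇒≈ (+-identityʳ x)) (≈-trans e (≡⇒≈ (sym x+d≡y)))

  Periodic : {A : Set} → (ℕ → A) → Set
  Periodic f = ∀ j → f (j + n) ≡ f j

  Periodic-+* : ∀ {A : Set} {f : ℕ → A} → Periodic f → ∀ j q → f (j + q * n) ≡ f j
  Periodic-+* {f = f} p j zero = cong f (+-identityʳ j)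
  Periodic-+* {f = f} p j (suc q) = begin
      f (j + (n + q * n))  ≡⟨ cong f (trans (cong (j +_) (+-comm n (q * n))) (sym (+-assoc j (q * n) n))) ⟩
      f (j + q * n + n)    ≡⟨ p (j + q * n) ⟩
      f (j + q * n)        ≡⟨ Periodic-+* p j q ⟩
      f j                  ∎
    where open ≡-Reasoning

  Periodic-% : ∀ {A : Set} {f : ℕ → A} → Periodic f → ∀ j → f (j % n) ≡ f j
  Periodic-% {f = f} p j =
    trans (sym (Periodic-+* p (j % n) (j / n))) (cong f (sym (m≡m%n+[m/n]*n j n)))

  Periodic-≈ : ∀ {A : Set} {f : ℕ → A} → Periodic f → ∀ {x y} → x ≈ y → f x ≡ f y
  Periodic-≈ {f = f} p {x} {y} (mk≈ e) = trans (sym (Periodic-% p x)) (trans (cong f e) (Periodic-% p y))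

  Periodic-realign : ∀ {A : Set} {f g : ℕ → A} → Periodic f → Periodic g → ∀ c z →
    (∀ d → d < n → f (c + d) ≡ g (z + d)) → ∃ λ r → r < n × ∀ j → f j ≡ g (j + r)
  Periodic-realign {f = f} {g} pf pg c z agree = r , m%n<n _ n , λ j →
      trans (Periodic-≈ pf (≈-sym (c+d≈j j))) (trans (agree (d j) (m%n<n _ n)) (Periodic-≈ pg (≈-sym (j+r≈z+d j))))
    where
      open ≈-Reasoning
      x = c % n
      x≤n : x ≤ n
      x≤n = <⇒≤ (m%n<n c n)
      r = (z + n ∸ x) % n
      d : ℕ → ℕ
      d j = (j + n ∸ x) % n
      c+d≈j : ∀ j → c + d j ≈ j
      c+d≈j j = begin
        c + d j              ≈⟨ +-cong-≈ (≈-sym (%-≈ c)) (%-≈ (j + n ∸ x)) ⟩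
        x + (j + n ∸ x)      ≡⟨ m+[n∸m]≡n (≤-trans x≤n (m≤n+m n j)) ⟩
        j + n                ≈⟨ +n≈ j ⟩
        j                    ∎
      j+r≈z+d : ∀ j → j + r ≈ z + d j
      j+r≈z+d j = begin
        j + r                ≈⟨ +-congˡ-≈ j (%-≈ (z + n ∸ x)) ⟩
        j + (z + n ∸ x)      ≡⟨ cong (j +_) (+-∸-assoc z x≤n) ⟩
        j + (z + (n ∸ x))    ≡⟨ +-assoc j z (n ∸ x) ⟨
        j + z + (n ∸ x)      ≡⟨ cong (_+ (n ∸ x)) (+-comm j z) ⟩
        z + j + (n ∸ x)      ≡⟨ +-assoc z j (n ∸ x) ⟩
        z + (j + (n ∸ x))    ≡⟨ cong (z +_) (+-∸-assoc j x≤n) ⟨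
        z + (j + n ∸ x)      ≈⟨ +-congˡ-≈ z (≈-sym (%-≈ (j + n ∸ x))) ⟩
        z + d j              ∎

  rotate-periodic : ∀ {A : Set} {f : ℕ → A} → Periodic f → ∀ {r} → r ≤ n →
    drop r (applyUpTo f n) ++ take r (applyUpTo f n) ≡ applyUpTo (λ j → f (j + r)) n
  rotate-periodic {f = f} per {r} r≤n = begin
      drop r (applyUpTo f n) ++ take r (applyUpTo f n)
    ≡⟨ cong (λ xs → drop r xs ++ take r xs) (cong (applyUpTo f) r+s≡n) ⟨
      drop r (applyUpTo f (r + s)) ++ take r (applyUpTo f (r + s))
    ≡⟨ cong₂ _++_ (drop-applyUpTo f r s) (take-applyUpTo f r s) ⟩
      applyUpTo (λ j → f (r + j)) s ++ applyUpTo f r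
    ≡⟨ cong₂ _++_ (applyUpTo-cong s (λ {j} _ → cong f (+-comm r j))) (applyUpTo-cong r (λ {j} _ → sym (wrap j))) ⟩
      applyUpTo (λ j → f (j + r)) s ++ applyUpTo (λ j → f (s + j + r)) r
    ≡⟨ applyUpTo-++ (λ j → f (j + r)) s r ⟨
      applyUpTo (λ j → f (j + r)) (s + r)
    ≡⟨ cong (applyUpTo (λ j → f (j + r))) (trans (+-comm s r) r+s≡n) ⟩
      applyUpTo (λ j → f (j + r)) n
    ∎
    where
      open ≡-Reasoning
      s = n ∸ r
      r+s≡n : r + s ≡ n
      r+s≡n = m+[n∸m]≡n r≤n
      wrap : ∀ j → f (s + j + r) ≡ f j
      wrap j = trans (cong f (trans (shuffle s j r) (cong (j +_) r+s≡n))) (per j)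
        where
          shuffle : ∀ s j r → s + j + r ≡ j + (r + s)
          shuffle = solve-∀

  resDiff-correct : ∀ {a b} → a < n → b < n → b + resDiff n a b ≈ a
  resDiff-correct {a} {b} a<n b<n with b ≤ᵇ a in eq
  ... | true = ≡⇒≈ (m+[n∸m]≡n (≤ᵇ⇒≤ b a (subst T (sym eq) tt)))
  ... | false = ≈-trans (≡⇒≈ (m+[n∸m]≡n b≤n+a)) (≈-trans (≡⇒≈ (+-comm n a)) (+n≈ a))
    where
      b≤n+a : b ≤ n + a
      b≤n+a = ≤-trans (<⇒≤ b<n) (m≤m+n n a)

  resDiff<n : ∀ {a b} → a < n → b < n → resDiff n a b < n
  resDiff<n {a} {b} a<n b<n with b ≤ᵇ a in eq
  ... | true = ≤-<-trans (m∸n≤m a b) a<n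
  ... | false = subst (n + a ∸ b <_) (m+n∸n≡m n a) (∸-monoʳ-< a<b (≤-trans (<⇒≤ b<n) (m≤m+n n a)))
    where
      a<b : a < b
      a<b = ≰⇒> (λ b≤a → subst T eq (≤⇒≤ᵇ b≤a))

  resDiff-unique : ∀ {a b r} → a < n → b < n → r < n → b + r ≈ a → r ≡ resDiff n a b
  resDiff-unique a<n b<n r<n e =
    ≈⇒≡ r<n (resDiff<n a<n b<n) (+-cancelˡ-≈ _ (≈-trans e (≈-sym (resDiff-correct a<n b<n))))

injective⇒surjective : ∀ {n} {f : Fin n → Fin n} → Injective _≡_ _≡_ f → ∀ v → ∃ λ i → f i ≡ v
injective⇒surjective {suc n} {f} inj v with any? (λ i → f i Fin.≟ v)
... | yes hit = hit
... | no miss = contradiction (injective⇒≤ punched-injective) (<-irrefl refl)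
  where
    punched : Fin (suc n) → Fin n
    punched i = punchOut {i = v} (λ e → miss (i , sym e))
    punched-injective : Injective _≡_ _≡_ punched
    punched-injective e = inj (punchOut-injective {i = v} _ _ e)

module _ {n : ℕ} where

  latin⇒unique : ∀ {xs : List (Fin n)} → xs ↭ allFin n → Unique xs
  latin⇒unique xs↭ = PermutationProperties.Unique-resp-↭ (setoid (Fin n)) (↭⇒↭ₛ (↭-sym xs↭)) (Unique.allFin⁺ n)

  unique∧complete⇒latin : ∀ {xs : List (Fin n)} → Unique xs → (∀ v → v ∈ xs) → xs ↭ allFin n
  unique∧complete⇒latin unique complete =
    ∼bag⇒↭ (unique∧set⇒bag unique (Unique.allFin⁺ n) (mk⇔ (λ _ → ∈-allFin _) (λ _ → complete _)))

module EvenLength (k : ℕ) (2≤k : 2 ≤ k) where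

  m : ℕ
  m = suc k

  n : ℕ
  n = m * 2

  open Congruence n public

  n≡m+m : n ≡ m + m
  n≡m+m = identity k
    where
      identity : ∀ k → suc k * 2 ≡ suc k + suc k
      identity = solve-∀

  n≡2+2k : n ≡ suc (suc (k + k))
  n≡2+2k = identity k
    where
      identity : ∀ k → suc k * 2 ≡ suc (suc (k + k))
      identity = solve-∀

  n≡k+[1+m] : n ≡ k + suc m
  n≡k+[1+m] = identity k
    where
      identity : ∀ k → suc k * 2 ≡ k + suc (suc k)
      identity = solve-∀

  n≡[1+m]+k : n ≡ suc m + k
  n≡[1+m]+k = identity k
    where
      identity : ∀ k → suc k * 2 ≡ suc (suc k) + k
      identity = solve-∀

  n/2≡m : n / 2 ≡ m
  n/2≡m = m*n/n≡m m 2

  0<n : 0 < n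
  0<n = z<s

  2<n : 2 < n
  2<n = subst (2 <_) (sym n≡2+2k) (s≤s (s≤s (≤-trans (≤-trans (s≤s z≤n) 2≤k) (m≤m+n k k))))

  m<n : m < n
  m<n = subst (m <_) (sym n≡m+m) (m<m+n m z<s)

  1+m<n : suc m < n
  1+m<n = subst (suc m <_) (sym n≡[1+m]+k) (m<m+n (suc m) (<-≤-trans z<s 2≤k))

  k<n : k < n
  k<n = <-trans (n<1+n k) m<n

  1+2k<n : suc (k + k) < n
  1+2k<n = subst (suc (k + k) <_) (sym n≡2+2k) (n<1+n _)

  Allowed : ℕ → Set
  Allowed h = h ≡ k ⊎ h ≡ m ⊎ h ≡ suc m

  Allowed⇒<n : ∀ {h} → Allowed h → h < n
  Allowed⇒<n (inj₁ refl) = k<n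
  Allowed⇒<n (inj₂ (inj₁ refl)) = m<n
  Allowed⇒<n (inj₂ (inj₂ refl)) = 1+m<n

  Allowed⇔range : ∀ {h} → Allowed h ⇔ (k ≤ h × h ≤ suc m)
  Allowed⇔range = mk⇔ to from
    where
      to : ∀ {h} → Allowed h → k ≤ h × h ≤ suc m
      to (inj₁ refl) = ≤-refl , m≤n+m k 2
      to (inj₂ (inj₁ refl)) = n≤1+n k , n≤1+n m
      to (inj₂ (inj₂ refl)) = m≤n+m k 2 , ≤-refl
      from : ∀ {h} → k ≤ h × h ≤ suc m → Allowed h
      from (k≤h , h≤2+k) with m≤n⇒∃[o]m+o≡n k≤h
      ... | 0 , refl = inj₁ (+-identityʳ k)
      ... | 1 , refl = inj₂ (inj₁ (+-comm k 1))
      ... | 2 , refl = inj₂ (inj₂ (+-comm k 2))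
      ... | suc (suc (suc d)) , refl =
        ⊥-elim (<-irrefl refl (≤-trans (subst (_≤ k + 3 + d) (+-comm k 3) (m≤m+n (k + 3) d))
                                      (subst (_≤ suc m) (sym (+-assoc k 3 d)) h≤2+k)))

  ≈0⇒≡0⊎≡n : ∀ {x} → x < n + n → x ≈ 0 → x ≡ 0 ⊎ x ≡ n
  ≈0⇒≡0⊎≡n {x} x<2n x≈0 with x <? n
  ... | yes x<n = inj₁ (≈⇒≡ x<n 0<n x≈0)
  ... | no x≮n = inj₂ (trans (sym (m∸n+n≡m n≤x)) (cong (_+ n) x∸n≡0))
    where
      n≤x = ≮⇒≥ x≮n
      x∸n≡0 : x ∸ n ≡ 0
      x∸n≡0 = ≈⇒≡ (+-cancelʳ-< _ _ n (subst (_< n + n) (sym (m∸n+n≡m n≤x)) x<2n)) 0<n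
                (≈-trans (≈-sym (+n≈ (x ∸ n))) (≈-trans (≡⇒≈ (m∸n+n≡m n≤x)) x≈0))

  resDiff-there-and-back : ∀ {a b} → a < n → b < n →
    let h = resDiff n b a ; u = resDiff n a b in h + u ≡ 0 ⊎ h + u ≡ n
  resDiff-there-and-back {a} {b} a<n b<n =
    ≈0⇒≡0⊎≡n (+-mono-< (resDiff<n b<n a<n) (resDiff<n a<n b<n)) (+-cancelˡ-≈ a a+[h+u]≈a+0)
    where
      open ≈-Reasoning
      h = resDiff n b a
      u = resDiff n a b
      a+[h+u]≈a+0 : a + (h + u) ≈ a + 0
      a+[h+u]≈a+0 = begin
        a + (h + u)  ≡⟨ +-assoc a h u ⟨
        a + h + u    ≈⟨ +-congʳ-≈ u (resDiff-correct b<n a<n) ⟩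
        b + u        ≈⟨ resDiff-correct a<n b<n ⟩
        a            ≡⟨ +-identityʳ a ⟨
        a + 0        ∎

  farApart⇔allowed : ∀ (x y : Fin n) → FarApart n x y ⇔ Allowed (resDiff n (toℕ y) (toℕ x))
  farApart⇔allowed x y = mk⇔ to from
    where
      a = toℕ x
      b = toℕ y
      h = resDiff n b a
      u = resDiff n a b
      farApart≡ : FarApart n x y ≡ (k ≤ u ⊓ h)
      farApart≡ = cong (λ t → t ∸ 1 ≤ dist n x y) n/2≡m
      sum = resDiff-there-and-back (toℕ<n x) (toℕ<n y)
      k≤sum⇒sum≡n : k ≤ h + u → h + u ≡ n
      k≤sum⇒sum≡n k≤ with sum
      ... | inj₁ e = ⊥-elim (<⇒≱ (<-≤-trans z<s 2≤k) (≤-trans k≤ (≤-reflexive e)))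
      ... | inj₂ e = e
      to : FarApart n x y → Allowed h
      to far = Allowed⇔range .Equivalence.from (k≤h , h≤1+m)
        where
          k≤u⊓h = subst id farApart≡ far
          k≤h = ≤-trans k≤u⊓h (m⊓n≤n u h)
          k≤u = ≤-trans k≤u⊓h (m⊓n≤m u h)
          h≤1+m : h ≤ suc m
          h≤1+m = +-cancelʳ-≤ k h (suc m) (begin
            h + k  ≤⟨ +-monoʳ-≤ h k≤u ⟩
            h + u  ≡⟨ trans (k≤sum⇒sum≡n (≤-trans k≤h (m≤m+n h u))) n≡[1+m]+k ⟩
            suc m + k ∎)
            where open ≤-Reasoning
      from : Allowed h → FarApart n x y
      from allowed = subst id (sym farApart≡) (⊓-glb k≤u k≤h)
        where
          k≤h = proj₁ (Allowed⇔range .Equivalence.to allowed)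
          h≤1+m = proj₂ (Allowed⇔range .Equivalence.to allowed)
          k≤u : k ≤ u
          k≤u = +-cancelˡ-≤ (suc m) k u (begin
            suc m + k  ≡⟨ trans (sym n≡[1+m]+k) (sym (k≤sum⇒sum≡n (≤-trans k≤h (m≤m+n h u)))) ⟩
            h + u      ≤⟨ +-monoˡ-≤ u h≤1+m ⟩
            suc m + u  ∎)
            where open ≤-Reasoning

  -- Rows as periodic functions

  step : (ℕ → ℕ) → ℕ → ℕ
  step F j = resDiff n (F (suc j)) (F j)

  record CyclicRow (F : ℕ → ℕ) : Set where
    field
      bounded : ∀ j → F j < n
      periodic : Periodic F
      starts-at-0 : F 0 ≡ 0
      injective : ∀ {i j} → i < j → j < n → F i ≢ F j
      allowed : ∀ j → Allowed (step F j)

    step-correct : ∀ j → F (suc j) ≈ F j + step F j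
    step-correct j = ≈-sym (resDiff-correct (bounded (suc j)) (bounded j))


  periodicRow : Vec (Fin n) n → ℕ → Fin n
  periodicRow s j = lookupOr s 0F (j % n)

  rowFunction : Vec (Fin n) n → ℕ → ℕ
  rowFunction s j = toℕ (periodicRow s j)

  toList-periodicRow : ∀ s → toList s ≡ applyUpTo (periodicRow s) n
  toList-periodicRow s = trans (toList-lookupOr s 0F) (applyUpTo-cong n (λ j<n → cong (lookupOr s 0F) (sym (m<n⇒m%n≡m j<n))))

  periodicRow-periodic : ∀ s → Periodic (periodicRow s)
  periodicRow-periodic s j = cong (lookupOr s 0F) ([m+n]%n≡m%n j n)

  Linked-periodic⇔cyclic : ∀ {R : Fin n → Fin n → Set} {g : ℕ → Fin n} → Periodic g →
    (∀ j → R (g j) (g (suc j))) ⇔ CyclicClosing R (applyUpTo g n)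
  Linked-periodic⇔cyclic {R} {g} per = mk⇔
    (λ linked → subst (Linked R) closed (Linked.applyUpTo⁺₂ g (suc n) linked))
    (λ cyclic j → subst₂ R (Periodic-% per j) (Periodic-≈ per (+-congˡ-≈ 1 (%-≈ j)))
                    (Linked-applyUpTo⁻ g (subst (Linked R) (sym closed) cyclic) (s<s (m%n<n j n))))
    where
      closed : applyUpTo g (suc n) ≡ applyUpTo g n ++ [ g 0 ]
      closed = trans (sym (applyUpTo-∷ʳ g n)) (cong (λ x → applyUpTo g n ∷ʳ x) (per 0))

  module _ {F : ℕ → ℕ} (row : CyclicRow F) where
    open CyclicRow row

    injective-on-period : ∀ {i j} → i < n → j < n → F i ≡ F j → i ≡ j
    injective-on-period {i} {j} i<n j<n e with <-cmp i j
    ... | tri< i<j _ _ = ⊥-elim (injective i<j j<n e)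
    ... | tri≈ _ i≡j _ = i≡j
    ... | tri> _ _ j<i = ⊥-elim (injective j<i i<n (sym e))

  rowFunction-cyclicRow : ∀ s → NormalCyclicMaxRow n s → CyclicRow (rowFunction s)
  rowFunction-cyclicRow s (latin , normal , _ , cyclic) = record
    { bounded = λ j → toℕ<n _
    ; periodic = λ j → cong toℕ (periodicRow-periodic s j)
    ; starts-at-0 = just-injective (subst (λ xs → head (map toℕ xs) ≡ just 0) (toList-periodicRow s) normal)
    ; injective = λ i<j j<n e → Unique-applyUpTo⁻ (periodicRow s) unique i<j j<n (toℕ-injective e)
    ; allowed = λ j → farApart⇔allowed (periodicRow s j) (periodicRow s (suc j)) .Equivalence.to (farApart j)
    }
    where
      unique = subst Unique (toList-periodicRow s) (latin⇒unique latin)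
      farApart = Linked-periodic⇔cyclic (periodicRow-periodic s) .Equivalence.from
                   (subst (CyclicClosing (FarApart n)) (toList-periodicRow s) cyclic)

  toFin : ℕ → Fin n
  toFin x = fromℕ< (m%n<n x n)

  rowOf : (ℕ → ℕ) → Vec (Fin n) n
  rowOf F = tabulateℕ (toFin ∘ F) n

  module _ {F : ℕ → ℕ} (row : CyclicRow F) where
    open CyclicRow row

    toℕ-toFin : ∀ j → toℕ (toFin (F j)) ≡ F j
    toℕ-toFin j = trans (toℕ-fromℕ< _) (m<n⇒m%n≡m (bounded j))

    periodicRow-rowOf : ∀ j → periodicRow (rowOf F) j ≡ toFin (F j)
    periodicRow-rowOf j = trans (lookupOr-tabulateℕ (toFin ∘ F) 0F (m%n<n j n)) (cong toFin (Periodic-% periodic j))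

    rowFunction-rowOf : ∀ j → rowFunction (rowOf F) j ≡ F j
    rowFunction-rowOf j = trans (cong toℕ (periodicRow-rowOf j)) (toℕ-toFin j)

    rowOf-valid : NormalCyclicMaxRow n (rowOf F)
    rowOf-valid = latin , normal , maxInner , cyclic
      where
        g = toFin ∘ F
        list≡ : toList (rowOf F) ≡ applyUpTo g n
        list≡ = toList-tabulateℕ g n
        g-injective : ∀ {i j} → i < n → j < n → g i ≡ g j → i ≡ j
        g-injective i<n j<n e = injective-on-period row i<n j<n
          (trans (sym (toℕ-toFin _)) (trans (cong toℕ e) (toℕ-toFin _)))
        latin : LatinRow n (rowOf F)
        latin = subst (_↭ allFin n) (sym list≡) (unique∧complete⇒latin
          (Unique.applyUpTo⁺₁ g n (λ i<j j<n → <⇒≢ i<j ∘ g-injective (<-trans i<j j<n) j<n))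
          (λ v → let (i , gi≡v) = injective⇒surjective
                         (λ e → toℕ-injective (g-injective (toℕ<n _) (toℕ<n _) e)) v
                 in subst (_∈ applyUpTo g n) gi≡v (∈-applyUpTo⁺ g (toℕ<n i))))
        normal : Normal n (rowOf F)
        normal = subst (λ xs → head (map toℕ xs) ≡ just 0) (sym list≡) (cong just (trans (toℕ-toFin 0) starts-at-0))
        farApart : ∀ j → FarApart n (g j) (g (suc j))
        farApart j = farApart⇔allowed (g j) (g (suc j)) .Equivalence.from
          (subst Allowed (sym (cong₂ (resDiff n) (toℕ-toFin (suc j)) (toℕ-toFin j))) (allowed j))
        maxInner : MaxInnerDistance n (rowOf F)
        maxInner = subst (Linked (FarApart n)) (sym list≡) (Linked.applyUpTo⁺₂ g n farApart)
        cyclic : CyclicClosing (FarApart n) (toList (rowOf F))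
        cyclic = subst (CyclicClosing (FarApart n)) (sym list≡)
          (Linked-periodic⇔cyclic (λ j → cong toFin (periodic j)) .Equivalence.to farApart)

  cyclicPairs-periodic : ∀ {A : Set} {g : ℕ → A} → Periodic g →
    cyclicPairs (applyUpTo g n) ≡ applyUpTo (λ j → g j , g (suc j)) n
  cyclicPairs-periodic {g = g} per = begin
      zip (applyUpTo g n) (applyUpTo (g ∘ suc) (suc (k * 2)) ++ [ g 0 ])
    ≡⟨ cong (λ x → zip (applyUpTo g n) (applyUpTo (g ∘ suc) (suc (k * 2)) ∷ʳ x)) (per 0) ⟨
      zip (applyUpTo g n) (applyUpTo (g ∘ suc) (suc (k * 2)) ∷ʳ g n)
    ≡⟨ cong (zip (applyUpTo g n)) (applyUpTo-∷ʳ (g ∘ suc) (suc (k * 2))) ⟩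
      zip (applyUpTo g n) (applyUpTo (g ∘ suc) n)
    ≡⟨ zip-applyUpTo g (g ∘ suc) n ⟩
      applyUpTo (λ j → g j , g (suc j)) n
    ∎
    where open ≡-Reasoning

  extDiffRow-steps : ∀ s → extDiffRow n s ≡ applyUpTo (λ j → ℤ.+ step (rowFunction s) j ℤ.- ℤ.+ m) n
  extDiffRow-steps s = begin
      map E (cyclicPairs (toList s))
    ≡⟨ cong (map E ∘ cyclicPairs) (toList-periodicRow s) ⟩
      map E (cyclicPairs (applyUpTo g n))
    ≡⟨ cong (map E) (cyclicPairs-periodic (periodicRow-periodic s)) ⟩
      map E (applyUpTo (λ j → g j , g (suc j)) n)
    ≡⟨ map-applyUpTo (λ j → g j , g (suc j)) E n ⟩
      applyUpTo (λ j → ℤ.+ step (rowFunction s) j ℤ.- ℤ.+ (n / 2)) n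
    ≡⟨ cong (λ h → applyUpTo (λ j → ℤ.+ step (rowFunction s) j ℤ.- ℤ.+ h) n) n/2≡m ⟩
      applyUpTo (λ j → ℤ.+ step (rowFunction s) j ℤ.- ℤ.+ m) n
    ∎
    where
      open ≡-Reasoning
      g = periodicRow s
      E : Fin n × Fin n → ℤ
      E (x , y) = ℤ.+ resDiff n (toℕ y) (toℕ x) ℤ.- ℤ.+ (n / 2)

  -- ε ∘ zigzag is the paper's (1, …, 1, 0, −1, …, −1, 0): see pattern₀≡zigzag.
  zigzag′ : ℕ → ℕ
  zigzag′ u with <-cmp u k
  ... | tri< _ _ _ = suc m
  ... | tri≈ _ _ _ = m
  ... | tri> _ _ _ with u <? suc (k + k)
  ...   | yes _ = k
  ...   | no _ = m

  zigzag : ℕ → ℕ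
  zigzag x = zigzag′ (x % n)

  zigzag-periodic : Periodic zigzag
  zigzag-periodic x = cong zigzag′ ([m+n]%n≡m%n x n)

  zigzag-rising : ∀ {u} → u < k → zigzag u ≡ suc m
  zigzag-rising {u} u<k with <-cmp (u % n) k | m<n⇒m%n≡m (<-trans u<k k<n)
  ... | tri< _ _ _ | _ = refl
  ... | tri≈ _ u≡k _ | u%n≡u = ⊥-elim (<-irrefl (trans (sym u%n≡u) u≡k) u<k)
  ... | tri> _ _ k<u | u%n≡u = ⊥-elim (<-asym u<k (subst (k <_) u%n≡u k<u))

  zigzag-peak : zigzag k ≡ m
  zigzag-peak with <-cmp (k % n) k | m<n⇒m%n≡m k<n
  ... | tri< u<k _ _ | u%n≡u = ⊥-elim (<-irrefl u%n≡u u<k)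
  ... | tri≈ _ _ _ | _ = refl
  ... | tri> _ _ k<u | u%n≡u = ⊥-elim (<-irrefl (sym u%n≡u) k<u)

  zigzag-falling : ∀ {u} → k < u → u < suc (k + k) → zigzag u ≡ k
  zigzag-falling {u} k<u u<1+2k rewrite m<n⇒m%n≡m (<-trans u<1+2k 1+2k<n) with <-cmp u k
  ... | tri< u<k _ _ = ⊥-elim (<-asym u<k k<u)
  ... | tri≈ _ u≡k _ = ⊥-elim (<-irrefl (sym u≡k) k<u)
  ... | tri> _ _ _ with u <? suc (k + k)
  ...   | yes _ = refl
  ...   | no u≮1+2k = ⊥-elim (u≮1+2k u<1+2k)

  zigzag-valley : zigzag (suc (k + k)) ≡ m
  zigzag-valley rewrite m<n⇒m%n≡m 1+2k<n with <-cmp (suc (k + k)) k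
  ... | tri< u<k _ _ = ⊥-elim (<-asym u<k (s≤s (m≤m+n k k)))
  ... | tri≈ _ u≡k _ = ⊥-elim (<-irrefl (sym u≡k) (s≤s (m≤m+n k k)))
  ... | tri> _ _ _ with suc (k + k) <? suc (k + k)
  ...   | yes u<u = ⊥-elim (<-irrefl refl u<u)
  ...   | no _ = refl

  zigzag-allowed : ∀ x → Allowed (zigzag x)
  zigzag-allowed x with <-cmp (x % n) k
  ... | tri< _ _ _ = inj₂ (inj₂ refl)
  ... | tri≈ _ _ _ = inj₂ (inj₁ refl)
  ... | tri> _ _ _ with x % n <? suc (k + k)
  ...   | yes _ = inj₁ refl
  ...   | no _ = inj₂ (inj₁ refl)

  zigzag≡m⇒turningPoint : ∀ {u} → u < n → zigzag u ≡ m → u ≡ k ⊎ u ≡ suc (k + k)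
  zigzag≡m⇒turningPoint {u} u<n zigzag≡m with <-cmp u k
  ... | tri< u<k _ _ = ⊥-elim (<-irrefl (trans (sym zigzag≡m) (zigzag-rising u<k)) (n<1+n m))
  ... | tri≈ _ u≡k _ = inj₁ u≡k
  ... | tri> _ _ k<u with <-cmp u (suc (k + k))
  ...   | tri< u<1+2k _ _ = ⊥-elim (<-irrefl (trans (sym (zigzag-falling k<u u<1+2k)) zigzag≡m) (n<1+n k))
  ...   | tri≈ _ u≡1+2k _ = inj₂ u≡1+2k
  ...   | tri> _ _ 1+2k<u = ⊥-elim (<-irrefl refl (<-≤-trans 1+2k<u (s≤s⁻¹ (subst (u <_) n≡2+2k u<n))))

  -- Classification of the steps

  data Shape (h : ℕ → ℕ) : Set where
    ascending : (∀ j → h j ≡ suc m) → Shape h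
    descending : (∀ j → h j ≡ k) → Shape h
    zigzagging : (r : ℕ) → r < n → (∀ j → h j ≡ zigzag (j + r)) → Shape h

  data PeriodPosition : ℕ → Set where
    start : PeriodPosition 0
    first-half : ∀ {i} → i < k → PeriodPosition (suc i)
    middle : PeriodPosition (suc k)
    second-half : ∀ {u} → u < k → PeriodPosition (suc k + suc u)

  periodPosition : ∀ d → d < n → PeriodPosition d
  periodPosition zero _ = start
  periodPosition (suc i) d<n with <-cmp i k
  ... | tri< i<k _ _ = first-half i<k
  ... | tri≈ _ refl _ = middle
  ... | tri> _ _ k<i with m≤n⇒∃[o]m+o≡n k<i
  ... | u , refl = subst PeriodPosition (+-suc (suc k) u) (second-half u<k)
    where
      u<k : u < k
      u<k = +-cancelˡ-< k u k (s<s⁻¹ (s<s⁻¹ (subst (suc (suc k + u) <_) n≡2+2k d<n)))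

  module Classification {F : ℕ → ℕ} (row : CyclicRow F) where
    open CyclicRow row

    h : ℕ → ℕ
    h = step F

    h-periodic : Periodic h
    h-periodic j = cong₂ (resDiff n) (periodic (suc j)) (periodic j)

    h-≈ : ∀ {x y} → x ≈ y → h x ≡ h y
    h-≈ = Periodic-≈ h-periodic

    advances-by : ∀ {j v} → h j ≡ v → F (suc j) ≈ F j + v
    advances-by {j} refl = step-correct j

    no-return : ∀ {x d} → 0 < d → d < n → F (x + d) ≈ F x → ⊥
    no-return {x} {d} 0<d d<n returns with <-cmp (x % n) ((x + d) % n)
    ... | tri< lt _ _ = injective lt (m%n<n (x + d) n) (trans (Periodic-% periodic x)
                          (trans (≈⇒≡ (bounded x) (bounded (x + d)) (≈-sym returns)) (sym (Periodic-% periodic (x + d)))))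
    ... | tri≈ _ eq _ = ≉-within-period (m<m+n x 0<d) (+-monoʳ-< x d<n) (mk≈ eq)
    ... | tri> _ _ gt = injective gt (m%n<n x n) (trans (Periodic-% periodic (x + d))
                          (trans (≈⇒≡ (bounded (x + d)) (bounded x) returns) (sym (Periodic-% periodic x))))

    two-steps≢n : ∀ j → h j + h (suc j) ≢ n
    two-steps≢n j sum≡n = no-return {j} {2} z<s 2<n
      (begin
        F (j + 2)               ≡⟨ cong F (+-comm j 2) ⟩
        F (suc (suc j))         ≈⟨ step-correct (suc j) ⟩
        F (suc j) + h (suc j)   ≈⟨ +-congʳ-≈ (h (suc j)) (step-correct j) ⟩
        F j + h j + h (suc j)   ≡⟨ trans (+-assoc (F j) (h j) (h (suc j))) (cong (F j +_) sum≡n) ⟩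
        F j + n                 ≈⟨ +n≈ (F j) ⟩
        F j                     ∎)
      where open ≈-Reasoning

    Trichotomy : ℕ → ℕ → Set
    Trichotomy a b = ∀ {x} → Allowed x → x ≡ a ⊎ x ≡ b ⊎ x ≡ m

    Turn : ℕ → ℕ → ℕ → Set
    Turn a b y = h y ≡ a × h (suc y) ≡ m × h (suc (suc y)) ≡ b

    Turn-≈ : ∀ {a b x y} → x ≈ y → Turn a b x → Turn a b y
    Turn-≈ x≈y (left , zero-at , right) =
      trans (h-≈ (≈-sym x≈y)) left ,
      trans (h-≈ (+-congˡ-≈ 1 (≈-sym x≈y))) zero-at ,
      trans (h-≈ (+-congˡ-≈ 2 (≈-sym x≈y))) right

    -- Around a step m at c = w + k + 1 flanked by a and b, F rises by exactly m across each symmetric window;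
    -- a step m at the border of the window would make F return after fewer than n steps.
    module FlankedZero (w a b : ℕ) (a+b≡n : a + b ≡ n) (only : Trichotomy a b) (turn : Turn a b (w + k)) where

      left : h (w + k) ≡ a
      left = proj₁ turn

      zero-at : h (suc (w + k)) ≡ m
      zero-at = proj₁ (proj₂ turn)

      right : h (suc (suc (w + k))) ≡ b
      right = proj₂ (proj₂ turn)

      c : ℕ
      c = suc (w + k)

      b+a≡n : b + a ≡ n
      b+a≡n = trans (+-comm b a) a+b≡n

      +m+m≈ : ∀ x → x + m + m ≈ x
      +m+m≈ x = ≈-trans (≡⇒≈ (trans (+-assoc x m m) (cong (x +_) (sym n≡m+m)))) (+n≈ x)

      extend-balance : ∀ {p R} → h (suc p) ≡ a → h R ≡ b → F R ≈ F (suc (suc p)) + m → F (suc R) ≈ F (suc p) + m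
      extend-balance {p} {R} hA hB balanced = begin
          F (suc R)                   ≈⟨ advances-by hB ⟩
          F R + b                     ≈⟨ +-congʳ-≈ b balanced ⟩
          F (suc (suc p)) + m + b     ≈⟨ +-congʳ-≈ b (+-congʳ-≈ m (advances-by hA)) ⟩
          F (suc p) + a + m + b       ≡⟨ rearrange (F (suc p)) a m b ⟩
          F (suc p) + m + (a + b)     ≡⟨ cong (F (suc p) + m +_) a+b≡n ⟩
          F (suc p) + m + n           ≈⟨ +n≈ _ ⟩
          F (suc p) + m               ∎
        where
          open ≈-Reasoning
          rearrange : ∀ x a m b → x + a + m + b ≡ x + m + (a + b)
          rearrange = solve-∀

      extend-left : ∀ {p R d} → h (suc p) ≡ a → h R ≡ b → F (suc R) ≈ F (suc p) + m →
                    suc R ≡ p + d → 0 < d → d < n → h p ≡ a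
      extend-left {p} {R} {d} hA hB balanced eq 0<d d<n with only (allowed p)
      ... | inj₁ ha = ha
      ... | inj₂ (inj₁ hb) = ⊥-elim (two-steps≢n p (trans (cong₂ _+_ hb hA) b+a≡n))
      ... | inj₂ (inj₂ hm) = ⊥-elim (no-return 0<d d<n (begin
          F (p + d)        ≡⟨ cong F eq ⟨
          F (suc R)        ≈⟨ balanced ⟩
          F (suc p) + m    ≈⟨ +-congʳ-≈ m (advances-by hm) ⟩
          F p + m + m      ≈⟨ +m+m≈ (F p) ⟩
          F p              ∎))
        where open ≈-Reasoning

      extend-right : ∀ {p R d} → h (suc p) ≡ a → h R ≡ b → F (suc R) ≈ F (suc p) + m →
                     suc (suc R) ≡ suc p + d → 0 < d → d < n → h (suc R) ≡ b
      extend-right {p} {R} {d} hA hB balanced eq 0<d d<n with only (allowed (suc R))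
      ... | inj₁ ha = ⊥-elim (two-steps≢n R (trans (cong₂ _+_ hB ha) b+a≡n))
      ... | inj₂ (inj₁ hb) = hb
      ... | inj₂ (inj₂ hm) = ⊥-elim (no-return 0<d d<n (begin
          F (suc p + d)        ≡⟨ cong F eq ⟨
          F (suc (suc R))      ≈⟨ advances-by hm ⟩
          F (suc R) + m        ≈⟨ +-congʳ-≈ m balanced ⟩
          F (suc p) + m + m    ≈⟨ +m+m≈ (F (suc p)) ⟩
          F (suc p)            ∎))
        where open ≈-Reasoning

      Window : ℕ → Set
      Window i = ∀ p → p + i ≡ w + k → h p ≡ a × h (suc c + i) ≡ b × F (suc c + i) ≈ F (suc p) + m

      window : ∀ i → i < k → Window i
      window zero _ p p+0≡w+k rewrite +-identityʳ p | p+0≡w+k | +-identityʳ (suc c) = left , right , advances-by zero-at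
      window (suc i) 1+i<k p p+1+i≡w+k with window i (<-trans (n<1+n i) 1+i<k) (suc p) (trans (sym (+-suc p i)) p+1+i≡w+k)
      ... | hA , hB , balanced =
          extend-left hA hB balanced′ distance 0<d d<n ,
          subst (λ x → h x ≡ b) R+1≡ (extend-right hA hB balanced′ (cong suc distance) 0<d d<n) ,
          subst (λ x → F x ≈ F (suc p) + m) R+1≡ balanced′
        where
          R = suc c + i
          R+1≡ : suc R ≡ suc c + suc i
          R+1≡ = sym (+-suc (suc c) i)
          balanced′ = extend-balance hA hB balanced
          d = 4 + i + i
          0<d : 0 < d
          0<d = z<s
          distance : suc R ≡ p + d
          distance = trans (cong (λ x → suc (suc (suc x)) + i) (sym p+1+i≡w+k)) (shuffle p i)
            where
              shuffle : ∀ p i → suc (suc (suc (p + suc i))) + i ≡ p + (4 + i + i)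
              shuffle = solve-∀
          d<n : d < n
          d<n = subst (d <_) (sym n≡2+2k) (≤-trans (n≤1+n _) (subst (_≤ suc (suc (k + k))) (bound i) (s≤s (s≤s (+-mono-≤ 1+i<k 1+i<k)))))
            where
              bound : ∀ i → suc (suc (suc (suc i) + suc (suc i))) ≡ suc (suc (4 + i + i))
              bound = solve-∀

      right-side : ∀ {i} → i < k → h (suc c + i) ≡ b
      right-side {i} i<k = proj₁ (proj₂ (window i i<k (w + (k ∸ i)) eq))
        where
          eq : w + (k ∸ i) + i ≡ w + k
          eq = trans (+-assoc w (k ∸ i) i) (cong (w +_) (m∸n+n≡m (<⇒≤ i<k)))

      left-side : ∀ {u} → 0 < u → u ≤ k → h (w + u) ≡ a
      left-side {u} 0<u u≤k = proj₁ (window (k ∸ u) (∸-monoʳ-< 0<u u≤k) (w + u) eq)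
        where
          eq : w + u + (k ∸ u) ≡ w + k
          eq = trans (+-assoc w u (k ∸ u)) (cong (w +_) (m+[n∸m]≡n u≤k))

      right-end : h (c + k) ≡ b
      right-end = trans (cong h (sym (trans (sym (+-suc c (pred k))) (cong (c +_) k-1+1≡k)))) (right-side (subst (pred k <_) k-1+1≡k (n<1+n _)))
        where
          k-1+1≡k : suc (pred k) ≡ k
          k-1+1≡k = suc-pred k {{>-nonZero (≤-trans (s≤s z≤n) 2≤k)}}

      beyond : h (suc (suc c + k)) ≡ a
      beyond = trans (h-≈ (≈-trans (≡⇒≈ (trans (shuffle w k) (cong (w + 1 +_) (sym n≡2+2k)))) (+n≈ (w + 1))))
                     (left-side z<s (≤-trans (s≤s z≤n) 2≤k))
        where
          shuffle : ∀ w k → suc (suc (suc (w + k)) + k) ≡ w + 1 + suc (suc (k + k))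
          shuffle = solve-∀

      opposite-zero : h (suc c + k) ≡ m
      opposite-zero with only (allowed (suc c + k))
      ... | inj₁ ha = ⊥-elim (two-steps≢n (c + k) (trans (cong₂ _+_ right-end ha) b+a≡n))
      ... | inj₂ (inj₁ hb) = ⊥-elim (two-steps≢n (suc c + k) (trans (cong₂ _+_ hb beyond) b+a≡n))
      ... | inj₂ (inj₂ hm) = hm

      at-center : h (c + 0) ≡ m
      at-center = trans (cong h (+-identityʳ c)) zero-at

      on-first-half : ∀ {i} → i < k → h (c + suc i) ≡ b
      on-first-half {i} i<k = trans (cong h (+-suc c i)) (right-side i<k)

      at-middle : h (c + suc k) ≡ m
      at-middle = trans (cong h (+-suc c k)) opposite-zero

      on-second-half : ∀ {u} → u < k → h (c + (suc k + suc u)) ≡ a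
      on-second-half {u} u<k =
        trans (h-≈ (≈-trans (≡⇒≈ (trans (shuffle w k u) (cong (w + suc u +_) (sym n≡2+2k)))) (+n≈ (w + suc u))))
              (left-side z<s u<k)
        where
          shuffle : ∀ w k u → suc (w + k) + (suc k + suc u) ≡ w + suc u + suc (suc (k + k))
          shuffle = solve-∀

    up-down-flat : Trichotomy (suc m) k
    up-down-flat (inj₁ x≡k) = inj₂ (inj₁ x≡k)
    up-down-flat (inj₂ (inj₁ x≡m)) = inj₂ (inj₂ x≡m)
    up-down-flat (inj₂ (inj₂ x≡1+m)) = inj₁ x≡1+m

    down-up-flat : Trichotomy k (suc m)
    down-up-flat (inj₁ x≡k) = inj₁ x≡k
    down-up-flat (inj₂ (inj₁ x≡m)) = inj₂ (inj₂ x≡m)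
    down-up-flat (inj₂ (inj₂ x≡1+m)) = inj₂ (inj₁ x≡1+m)

    peak-shape : ∀ w → Turn (suc m) k (w + k) → Shape h
    peak-shape w peak =
      let (r , r<n , agree) = Periodic-realign h-periodic zigzag-periodic c k matches in zigzagging r r<n agree
      where
        open FlankedZero w (suc m) k (sym n≡[1+m]+k) up-down-flat peak
        matches : ∀ d → d < n → h (c + d) ≡ zigzag (k + d)
        matches d d<n with periodPosition d d<n
        ... | start = trans at-center (sym (trans (cong zigzag (+-identityʳ k)) zigzag-peak))
        ... | first-half {i} i<k = trans (on-first-half i<k) (sym (zigzag-falling (m<m+n k z<s) (s≤s (+-monoʳ-≤ k i<k))))
        ... | middle = trans at-middle (sym (trans (cong zigzag (+-suc k k)) zigzag-valley))
        ... | second-half {u} u<k = trans (on-second-half u<k) (sym (begin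
            zigzag (k + (suc k + suc u))  ≡⟨ cong zigzag (trans (shuffle k u) (cong (u +_) (sym n≡2+2k))) ⟩
            zigzag (u + n)                ≡⟨ zigzag-periodic u ⟩
            zigzag u                      ≡⟨ zigzag-rising u<k ⟩
            suc m                         ∎))
          where
            open ≡-Reasoning
            shuffle : ∀ k u → k + (suc k + suc u) ≡ u + suc (suc (k + k))
            shuffle = solve-∀

    -- A valley forces a peak k + 1 steps later.
    valley-shape : ∀ w → Turn k (suc m) (w + k) → Shape h
    valley-shape w valley = peak-shape c (right-end , opposite-zero , beyond)
      where open FlankedZero w k (suc m) (sym n≡k+[1+m]) down-up-flat valley

    stepSum : ℕ → ℕ → ℕ
    stepSum x zero = 0
    stepSum x (suc t) = h x + stepSum (suc x) t

    F-stepSum : ∀ t x → F (x + t) ≈ F x + stepSum x t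
    F-stepSum zero x = ≡⇒≈ (trans (cong F (+-identityʳ x)) (sym (+-identityʳ (F x))))
    F-stepSum (suc t) x = begin
        F (x + suc t)                     ≡⟨ cong F (+-suc x t) ⟩
        F (suc x + t)                     ≈⟨ F-stepSum t (suc x) ⟩
        F (suc x) + stepSum (suc x) t     ≈⟨ +-congʳ-≈ (stepSum (suc x) t) (step-correct x) ⟩
        F x + h x + stepSum (suc x) t     ≡⟨ +-assoc (F x) (h x) (stepSum (suc x) t) ⟩
        F x + stepSum x (suc t)           ∎
      where open ≈-Reasoning

    stepSum-period : ∀ x → stepSum x n ≈ 0
    stepSum-period x = +-cancelˡ-≈ (F x) (≈-trans (≈-sym (F-stepSum n x)) (≡⇒≈ (trans (periodic x) (sym (+-identityʳ (F x))))))

    n*m≈0 : n * m ≈ 0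
    n*m≈0 = mk≈ (trans (cong (_% n) (*-comm n m)) (m*n%n≡0 m n))

    1+c≉0 : ∀ {c} → c ≤ k * 2 → ¬ (suc c ≈ 0)
    1+c≉0 c≤2k 1+c≈0 with ≈⇒≡ (s≤s (s≤s c≤2k)) 0<n 1+c≈0
    ... | ()

    stepSum-up : ∀ t x → (∀ {i} → i < t → h (x + i) ≡ suc m ⊎ h (x + i) ≡ m) → ∃ λ c → c ≤ t × stepSum x t ≡ t * m + c
    stepSum-up zero x _ = 0 , z≤n , refl
    stepSum-up (suc t) x up-or-flat
      with stepSum-up t (suc x) (λ i<t → subst (λ y → h y ≡ suc m ⊎ h y ≡ m) (+-suc x _) (up-or-flat (s<s i<t)))
         | subst (λ y → h y ≡ suc m ⊎ h y ≡ m) (+-identityʳ x) (up-or-flat z<s)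
    ... | c , c≤t , sum≡ | inj₁ up = suc c , s≤s c≤t , trans (cong₂ _+_ up sum≡) (shuffle m (t * m) c)
      where
        shuffle : ∀ a b c → suc a + (b + c) ≡ a + b + suc c
        shuffle = solve-∀
    ... | c , c≤t , sum≡ | inj₂ flat = c , m≤n⇒m≤1+n c≤t , trans (cong₂ _+_ flat sum≡) (sym (+-assoc m (t * m) c))

    stepSum-down : ∀ t x → (∀ {i} → i < t → h (x + i) ≡ k ⊎ h (x + i) ≡ m) → ∃ λ c → c ≤ t × stepSum x t + c ≡ t * m
    stepSum-down zero x _ = 0 , z≤n , refl
    stepSum-down (suc t) x down-or-flat
      with stepSum-down t (suc x) (λ i<t → subst (λ y → h y ≡ k ⊎ h y ≡ m) (+-suc x _) (down-or-flat (s<s i<t)))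
         | subst (λ y → h y ≡ k ⊎ h y ≡ m) (+-identityʳ x) (down-or-flat z<s)
    ... | c , c≤t , sum≡ | inj₁ down = suc c , s≤s c≤t ,
          trans (cong (λ v → v + stepSum (suc x) t + suc c) down) (trans (shuffle k (stepSum (suc x) t) c) (cong (suc k +_) sum≡))
      where
        shuffle : ∀ a b c → a + b + suc c ≡ suc a + (b + c)
        shuffle = solve-∀
    ... | c , c≤t , sum≡ | inj₂ flat = c , m≤n⇒m≤1+n c≤t ,
          trans (cong (λ v → v + stepSum (suc x) t + c) flat) (trans (+-assoc m (stepSum (suc x) t) c) (cong (m +_) sum≡))

    monotone-run : ∀ {a b} → a + b ≡ n → Trichotomy a b → (∀ y → ¬ Turn a b y) →
                   ∀ {x} → h x ≡ a → ∀ t → h (x + t) ≡ a ⊎ h (x + t) ≡ m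
    monotone-run {a} {b} a+b≡n only no-turn {x} hx≡a t with invariant t
      where
        invariant : ∀ t → h (x + t) ≡ a ⊎ (h (x + t) ≡ m × h (x + suc t) ≡ a)
        invariant zero = inj₁ (trans (cong h (+-identityʳ x)) hx≡a)
        invariant (suc t) with invariant t
        ... | inj₂ (_ , next) = inj₁ next
        ... | inj₁ current with only (allowed (x + suc t))
        ...   | inj₁ next = inj₁ next
        ...   | inj₂ (inj₁ next) = ⊥-elim (two-steps≢n (x + t) (trans (cong₂ _+_ current (trans (cong h (sym (+-suc x t))) next)) a+b≡n))
        ...   | inj₂ (inj₂ flat) = inj₂ (flat , after)
          where
            flat′ : h (suc (x + t)) ≡ m
            flat′ = trans (cong h (sym (+-suc x t))) flat
            position : x + suc (suc t) ≡ suc (suc (x + t))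
            position = trans (+-suc x (suc t)) (cong suc (+-suc x t))
            after : h (x + suc (suc t)) ≡ a
            after with only (allowed (suc (suc (x + t))))
            ... | inj₁ next = trans (cong h position) next
            ... | inj₂ (inj₁ next) = ⊥-elim (no-turn (x + t) (current , flat′ , next))
            ... | inj₂ (inj₂ flat″) = ⊥-elim (two-steps≢n (suc (x + t)) (trans (cong₂ _+_ flat′ flat″) (sym n≡m+m)))
    ... | inj₁ same-sign = inj₁ same-sign
    ... | inj₂ (flat , _) = inj₂ flat

    -- Over one period the steps sum to n · m plus (resp. minus) the number of steps m + 1
    -- (resp. m − 1), which lies strictly between 0 and n.
    no-up-run : ∀ {x} → h x ≡ suc m → h (suc x) ≡ m → (∀ t → h (x + t) ≡ suc m ⊎ h (x + t) ≡ m) → ⊥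
    no-up-run {x} up flat run with stepSum-up (k * 2) (suc (suc x)) (λ {i} _ → subst (λ y → h y ≡ suc m ⊎ h y ≡ m) (position i) (run (suc (suc i))))
      where
        position : ∀ i → x + suc (suc i) ≡ suc (suc x) + i
        position i = trans (+-suc x (suc i)) (cong suc (+-suc x i))
    ... | c , c≤2k , sum≡ = 1+c≉0 c≤2k (begin
        suc c              ≈⟨ +-congʳ-≈ (suc c) n*m≈0 ⟨
        n * m + suc c      ≡⟨ whole-period ⟨
        stepSum x n        ≈⟨ stepSum-period x ⟩
        0                  ∎)
      where
        open ≈-Reasoning
        whole-period : stepSum x n ≡ n * m + suc c
        whole-period = trans (cong₂ (λ u v → u + (v + stepSum (suc (suc x)) (k * 2))) up flat)
                             (trans (cong (λ v → suc m + (m + v)) sum≡) (count k c))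
          where
            count : ∀ k c → suc (suc k) + (suc k + (k * 2 * suc k + c)) ≡ suc k * 2 * suc k + suc c
            count = solve-∀

    no-down-run : ∀ {x} → h x ≡ k → h (suc x) ≡ m → (∀ t → h (x + t) ≡ k ⊎ h (x + t) ≡ m) → ⊥
    no-down-run {x} down flat run with stepSum-down (k * 2) (suc (suc x)) (λ {i} _ → subst (λ y → h y ≡ k ⊎ h y ≡ m) (position i) (run (suc (suc i))))
      where
        position : ∀ i → x + suc (suc i) ≡ suc (suc x) + i
        position i = trans (+-suc x (suc i)) (cong suc (+-suc x i))
    ... | c , c≤2k , sum≡ = 1+c≉0 c≤2k (begin
        suc c                  ≈⟨ +-congʳ-≈ (suc c) (stepSum-period x) ⟨
        stepSum x n + suc c    ≡⟨ whole-period ⟩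
        n * m                  ≈⟨ n*m≈0 ⟩
        0                      ∎)
      where
        open ≈-Reasoning
        whole-period : stepSum x n + suc c ≡ n * m
        whole-period = trans (cong₂ (λ u v → u + (v + stepSum (suc (suc x)) (k * 2)) + suc c) down flat)
                             (trans (count k (stepSum (suc (suc x)) (k * 2)) c) (cong (λ v → suc k + (suc k + v)) sum≡))
          where
            count : ∀ k s c → k + (suc k + s) + suc c ≡ suc k + (suc k + (s + c))
            count = solve-∀

    every-zero-is-a-turn : (∀ y → ¬ Turn (suc m) k y) → (∀ y → ¬ Turn k (suc m) y) → ∀ j → h j ≢ m
    every-zero-is-a-turn no-peak no-valley j hj≡m = impossible (allowed x)
      where
        x = j + suc (k * 2)
        flat : h (suc x) ≡ m
        flat = trans (cong h (sym (+-suc j (suc (k * 2))))) (trans (h-periodic j) hj≡m)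
        impossible : Allowed (h x) → ⊥
        impossible (inj₁ down) = no-down-run down flat (monotone-run (sym n≡k+[1+m]) down-up-flat no-valley down)
        impossible (inj₂ (inj₁ flat′)) = two-steps≢n x (trans (cong₂ _+_ flat′ flat) (sym n≡m+m))
        impossible (inj₂ (inj₂ up)) = no-up-run up flat (monotone-run (sym n≡[1+m]+k) up-down-flat no-peak up)

    no-flat⇒constant : (∀ j → h j ≢ m) → ∀ j → h j ≡ h 0
    no-flat⇒constant no-flat zero = refl
    no-flat⇒constant no-flat (suc j) with allowed (suc j) | allowed j
    ... | inj₂ (inj₁ flat) | _ = ⊥-elim (no-flat (suc j) flat)
    ... | _ | inj₂ (inj₁ flat) = ⊥-elim (no-flat j flat)
    ... | inj₁ e | inj₁ e′ = trans e (trans (sym e′) (no-flat⇒constant no-flat j))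
    ... | inj₂ (inj₂ e) | inj₂ (inj₂ e′) = trans e (trans (sym e′) (no-flat⇒constant no-flat j))
    ... | inj₁ e | inj₂ (inj₂ e′) = ⊥-elim (two-steps≢n j (trans (cong₂ _+_ e′ e) (sym n≡[1+m]+k)))
    ... | inj₂ (inj₂ e) | inj₁ e′ = ⊥-elim (two-steps≢n j (trans (cong₂ _+_ e′ e) (sym n≡k+[1+m])))

    constant-shape : (∀ j → h j ≢ m) → Shape h
    constant-shape no-flat with allowed 0
    ... | inj₁ down = descending (λ j → trans (no-flat⇒constant no-flat j) down)
    ... | inj₂ (inj₁ flat) = ⊥-elim (no-flat 0 flat)
    ... | inj₂ (inj₂ up) = ascending (λ j → trans (no-flat⇒constant no-flat j) up)

    turn? : ∀ a b y → Dec (Turn a b y)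
    turn? a b y = (h y ≟ a) ×-dec ((h (suc y) ≟ m) ×-dec (h (suc (suc y)) ≟ b))

    no-turn-anywhere : ∀ {a b} → ¬ (∃ λ (i : Fin n) → Turn a b (toℕ i)) → ∀ y → ¬ Turn a b y
    no-turn-anywhere none y turn = none (toFin y , Turn-≈ (≈-trans (≈-sym (%-≈ y)) (≡⇒≈ (sym (toℕ-fromℕ< _)))) turn)

    period-shift : ∀ y → y ≈ y + suc (suc k) + k
    period-shift y = ≈-sym (≈-trans (≡⇒≈ (trans (+-assoc y (suc (suc k)) k) (cong (y +_) (sym n≡[1+m]+k)))) (+n≈ y))

    classify : Shape h
    classify with any? (λ i → turn? (suc m) k (toℕ i)) | any? (λ i → turn? k (suc m) (toℕ i))
    ... | yes (i , peak) | _ = peak-shape (toℕ i + suc (suc k)) (Turn-≈ (period-shift (toℕ i)) peak)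
    ... | no _ | yes (i , valley) = valley-shape (toℕ i + suc (suc k)) (Turn-≈ (period-shift (toℕ i)) valley)
    ... | no no-peak | no no-valley = constant-shape (every-zero-is-a-turn (no-turn-anywhere no-peak) (no-turn-anywhere no-valley))

  -- Rows realising the possible steps

  bit : Parity → ℕ
  bit 0ℙ = 0
  bit 1ℙ = 1

  bit≤1 : ∀ p → bit p ≤ 1
  bit≤1 0ℙ = z≤n
  bit≤1 1ℙ = s≤s z≤n

  halves : ∀ t → t ≡ ⌊ t /2⌋ + ⌊ t /2⌋ + bit (parity t)
  halves zero = refl
  halves (suc zero) = refl
  halves (suc (suc t)) = trans (cong (suc ∘ suc) (halves t)) (shuffle ⌊ t /2⌋ (bit (parity t)))
    where
      shuffle : ∀ q p → suc (suc (q + q + p)) ≡ suc q + suc q + p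
      shuffle = solve-∀

  parity-same⇒even-sum : ∀ a b → parity a ≡ parity b → parity (a + b) ≡ 0ℙ
  parity-same⇒even-sum a b same = trans (ℙ.+-homo-+ a b) (trans (cong (_+ℙ parity b) same) (ℙ.p+p≡0ℙ (parity b)))

  parity-double : ∀ q → parity (q + q) ≡ 0ℙ
  parity-double q = parity-same⇒even-sum q q refl

  parity-odd : ∀ q → parity (suc (q + q)) ≡ 1ℙ
  parity-odd q = trans (ℙ.+-homo-+ 1 (q + q)) (cong (1ℙ +ℙ_) (parity-double q))

  *m≈bit*m : ∀ d → d * m ≈ bit (parity d) * m
  *m≈bit*m d = begin
      d * m                          ≡⟨ cong (_* m) (halves d) ⟩
      (q + q + b) * m                ≡⟨ shuffle q b m ⟩
      b * m + q * (m + m)            ≡⟨ cong (λ x → b * m + q * x) n≡m+m ⟨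
      b * m + q * n                  ≈⟨ mk≈ ([m+kn]%n≡m%n (b * m) q n) ⟩
      b * m                          ∎
    where
      open ≈-Reasoning
      q = ⌊ d /2⌋
      b = bit (parity d)
      shuffle : ∀ q p m → (q + q + p) * m ≡ p * m + q * (m + m)
      shuffle = solve-∀

  bit-suc*m : ∀ t → bit (parity (suc t)) * m ≈ bit (parity t) * m + m
  bit-suc*m t = ≈-trans (≈-sym (*m≈bit*m (suc t))) (≈-trans (≡⇒≈ (+-comm m (t * m))) (+-congʳ-≈ m (*m≈bit*m t)))

  offset : ℕ → ℕ
  offset t with t <? m
  ... | yes _ = t
  ... | no _ = suc (k + k) ∸ t

  offset-low : ∀ {t} → t < m → offset t ≡ t
  offset-low {t} t<m with t <? m
  ... | yes _ = refl
  ... | no t≮m = ⊥-elim (t≮m t<m)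

  offset-high : ∀ {t} → m ≤ t → offset t ≡ suc (k + k) ∸ t
  offset-high {t} m≤t with t <? m
  ... | yes t<m = ⊥-elim (<⇒≱ t<m m≤t)
  ... | no _ = refl

  offset<m : ∀ t → offset t < m
  offset<m t with t <? m
  ... | yes t<m = t<m
  ... | no t≮m = ≤-<-trans (∸-monoʳ-≤ (suc (k + k)) (≮⇒≥ t≮m)) (subst (_< m) (sym (m+n∸m≡n k k)) (n<1+n k))

  zigzagRow : ℕ → ℕ
  zigzagRow t = offset t + bit (parity t) * m

  zigzagRow<n : ∀ t → zigzagRow t < n
  zigzagRow<n t = subst (zigzagRow t <_) (sym n≡m+m)
    (+-mono-<-≤ (offset<m t) (≤-trans (*-monoˡ-≤ m (bit≤1 (parity t))) (≤-reflexive (+-identityʳ m))))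

  bit-injective : ∀ {p q} → bit p ≡ bit q → p ≡ q
  bit-injective {0ℙ} {0ℙ} _ = refl
  bit-injective {1ℙ} {1ℙ} _ = refl

  digits-unique : ∀ {x y p q} → x < m → y < m → x + bit p * m ≡ y + bit q * m → x ≡ y × p ≡ q
  digits-unique {x} {y} {p} {q} x<m y<m e = x≡y , bit-injective (*-cancelʳ-≡ (bit p) (bit q) m (+-cancelˡ-≡ x _ _ (trans e (cong (_+ bit q * m) (sym x≡y)))))
    where
      x≡y : x ≡ y
      x≡y = begin
        x                       ≡⟨ m<n⇒m%n≡m x<m ⟨
        x % m                   ≡⟨ [m+kn]%n≡m%n x (bit p) m ⟨
        (x + bit p * m) % m     ≡⟨ cong (_% m) e ⟩
        (y + bit q * m) % m     ≡⟨ [m+kn]%n≡m%n y (bit q) m ⟩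
        y % m                   ≡⟨ m<n⇒m%n≡m y<m ⟩
        y                       ∎
        where open ≡-Reasoning

  <n⇒≤1+2k : ∀ {t} → t < n → t ≤ suc (k + k)
  <n⇒≤1+2k {t} t<n = s≤s⁻¹ (subst (t <_) n≡2+2k t<n)

  mirror : ∀ {u v} → u < m → m ≤ v → v < n → parity u ≡ parity v → u ≡ suc (k + k) ∸ v → ⊥
  mirror {u} {v} u<m m≤v v<n same u≡ with trans (sym (parity-same⇒even-sum u v same)) (trans (cong parity sum≡) (parity-odd k))
    where
      sum≡ : u + v ≡ suc (k + k)
      sum≡ = trans (cong (_+ v) u≡) (m∸n+n≡m (<n⇒≤1+2k v<n))
  ... | ()

  offset-injective : ∀ {u v} → u < n → v < n → parity u ≡ parity v → offset u ≡ offset v → u ≡ v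
  offset-injective {u} {v} u<n v<n same e with m ≤? u | m ≤? v
  ... | no m≰u | no m≰v = trans (sym (offset-low (≰⇒> m≰u))) (trans e (offset-low (≰⇒> m≰v)))
  ... | yes m≤u | yes m≤v = begin
      u                          ≡⟨ m∸[m∸n]≡n (<n⇒≤1+2k u<n) ⟨
      suc (k + k) ∸ (suc (k + k) ∸ u) ≡⟨ cong (suc (k + k) ∸_) (offset-high m≤u) ⟨
      suc (k + k) ∸ offset u     ≡⟨ cong (suc (k + k) ∸_) e ⟩
      suc (k + k) ∸ offset v     ≡⟨ cong (suc (k + k) ∸_) (offset-high m≤v) ⟩
      suc (k + k) ∸ (suc (k + k) ∸ v) ≡⟨ m∸[m∸n]≡n (<n⇒≤1+2k v<n) ⟩
      v                          ∎
    where open ≡-Reasoning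
  ... | no m≰u | yes m≤v = ⊥-elim (mirror (≰⇒> m≰u) m≤v v<n same (trans (sym (offset-low (≰⇒> m≰u))) (trans e (offset-high m≤v))))
  ... | yes m≤u | no m≰v = ⊥-elim (mirror (≰⇒> m≰v) m≤u u<n (sym same) (trans (sym (offset-low (≰⇒> m≰v))) (trans (sym e) (offset-high m≤u))))

  zigzagRow-injective : ∀ {u v} → u < n → v < n → zigzagRow u ≡ zigzagRow v → u ≡ v
  zigzagRow-injective {u} {v} u<n v<n e =
    let (offsets , parities) = digits-unique {p = parity u} {parity v} (offset<m u) (offset<m v) e
    in offset-injective u<n v<n parities offsets

  zigzagRow-rising : ∀ {u} → u < k → zigzagRow (suc u) ≈ zigzagRow u + suc m
  zigzagRow-rising {u} u<k = begin
      offset (suc u) + b′ * m      ≡⟨ cong (_+ b′ * m) (offset-low (s≤s u<k)) ⟩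
      suc u + b′ * m               ≈⟨ +-congˡ-≈ (suc u) (bit-suc*m u) ⟩
      suc u + (b * m + m)          ≡⟨ shuffle u (b * m) m ⟩
      u + b * m + suc m            ≡⟨ cong (λ x → x + b * m + suc m) (offset-low (<-trans u<k (n<1+n k))) ⟨
      offset u + b * m + suc m     ∎
    where
      open ≈-Reasoning
      b = bit (parity u)
      b′ = bit (parity (suc u))
      shuffle : ∀ u p m → suc u + (p + m) ≡ u + p + suc m
      shuffle = solve-∀

  zigzagRow-peak : zigzagRow m ≈ zigzagRow k + m
  zigzagRow-peak = begin
      offset m + bit (parity m) * m       ≡⟨ cong (_+ bit (parity m) * m) (trans (offset-high ≤-refl) (m+n∸m≡n k k)) ⟩
      k + bit (parity m) * m              ≈⟨ +-congˡ-≈ k (bit-suc*m k) ⟩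
      k + (bit (parity k) * m + m)        ≡⟨ +-assoc k _ m ⟨
      k + bit (parity k) * m + m          ≡⟨ cong (λ x → x + bit (parity k) * m + m) (offset-low (n<1+n k)) ⟨
      offset k + bit (parity k) * m + m   ∎
    where open ≈-Reasoning

  zigzagRow-falling : ∀ {u} → k < u → u < suc (k + k) → zigzagRow (suc u) ≈ zigzagRow u + k
  zigzagRow-falling {u} k<u u<1+2k = begin
      offset (suc u) + b′ * m                 ≡⟨ cong (_+ b′ * m) (offset-high (≤-trans k<u (n≤1+n u))) ⟩
      (k + k ∸ u) + b′ * m                    ≈⟨ +-congˡ-≈ (k + k ∸ u) (bit-suc*m u) ⟩
      (k + k ∸ u) + (b * m + suc k)           ≡⟨ shuffle (k + k ∸ u) (b * m) k ⟩
      suc (k + k ∸ u) + b * m + k             ≡⟨ cong (λ x → x + b * m + k) (trans (offset-high k<u) (+-∸-assoc 1 (s≤s⁻¹ u<1+2k))) ⟨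
      offset u + b * m + k                    ∎
    where
      open ≈-Reasoning
      b = bit (parity u)
      b′ = bit (parity (suc u))
      shuffle : ∀ v p k → v + (p + suc k) ≡ suc v + p + k
      shuffle = solve-∀

  zigzagRow-last : zigzagRow (suc (k + k)) ≡ m
  zigzagRow-last = trans (cong₂ (λ x p → x + bit p * m) offset≡0 (parity-odd k)) (+-identityʳ m)
    where
      offset≡0 : offset (suc (k + k)) ≡ 0
      offset≡0 = trans (offset-high (s≤s (m≤m+n k k))) (n∸n≡0 (suc (k + k)))

  zigzagRow-step : ∀ {u} → u < n → zigzagRow (suc u % n) ≈ zigzagRow u + zigzag u
  zigzagRow-step {u} u<n with <-cmp u k
  ... | tri< u<k _ _ = ≈-trans (≡⇒≈ (cong zigzagRow (m<n⇒m%n≡m (<-trans (s≤s u<k) m<n))))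
                         (≈-trans (zigzagRow-rising u<k) (≡⇒≈ (cong (zigzagRow u +_) (sym (zigzag-rising u<k)))))
  ... | tri≈ _ refl _ = ≈-trans (≡⇒≈ (cong zigzagRow (m<n⇒m%n≡m m<n)))
                          (≈-trans zigzagRow-peak (≡⇒≈ (cong (zigzagRow k +_) (sym zigzag-peak))))
  ... | tri> _ _ k<u with suc u <? n
  ...   | yes 1+u<n = ≈-trans (≡⇒≈ (cong zigzagRow (m<n⇒m%n≡m 1+u<n)))
                        (≈-trans (zigzagRow-falling k<u u<1+2k) (≡⇒≈ (cong (zigzagRow u +_) (sym (zigzag-falling k<u u<1+2k)))))
    where
      u<1+2k : u < suc (k + k)
      u<1+2k = s<s⁻¹ (subst (suc u <_) n≡2+2k 1+u<n)
  ...   | no 1+u≮n = begin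
      zigzagRow (suc u % n)                   ≡⟨ cong (λ x → zigzagRow (x % n)) 1+u≡n ⟩
      zigzagRow (n % n)                       ≡⟨ cong zigzagRow (n%n≡0 n) ⟩
      0                                       ≈⟨ n≈0 ⟨
      n                                       ≡⟨ n≡m+m ⟩
      m + m                                   ≡⟨ cong₂ _+_ zigzagRow-last zigzag-valley ⟨
      zigzagRow (suc (k + k)) + zigzag (suc (k + k))  ≡⟨ cong (λ x → zigzagRow x + zigzag x) u≡1+2k ⟨
      zigzagRow u + zigzag u                  ∎
    where
      open ≈-Reasoning
      1+u≡n : suc u ≡ n
      1+u≡n = ≤-antisym u<n (≮⇒≥ 1+u≮n)
      u≡1+2k : u ≡ suc (k + k)
      u≡1+2k = suc-injective (trans 1+u≡n n≡2+2k)

  ≈⇒step≡ : ∀ {F : ℕ → ℕ} {j v} → (∀ j → F j < n) → v < n → F (suc j) ≈ F j + v → step F j ≡ v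
  ≈⇒step≡ bounded v<n e = sym (resDiff-unique (bounded _) (bounded _) v<n (≈-sym e))

  rotatedRow : ℕ → ℕ → ℕ
  rotatedRow r j = (zigzagRow ((j + r) % n) + (n ∸ zigzagRow (r % n))) % n

  module _ (r : ℕ) where
    private
      shift-back = n ∸ zigzagRow (r % n)

    rotatedRow<n : ∀ j → rotatedRow r j < n
    rotatedRow<n j = m%n<n (zigzagRow ((j + r) % n) + shift-back) n

    rotatedRow-step : ∀ j → rotatedRow r (suc j) ≈ rotatedRow r j + zigzag (j + r)
    rotatedRow-step j = begin
        rotatedRow r (suc j)                                    ≈⟨ %-≈ (zigzagRow ((suc j + r) % n) + shift-back) ⟩
        zigzagRow (suc (j + r) % n) + shift-back                ≡⟨ cong (λ x → zigzagRow x + shift-back) (%-distribˡ-+ 1 (j + r) n) ⟩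
        zigzagRow (suc ((j + r) % n) % n) + shift-back          ≈⟨ +-congʳ-≈ shift-back (zigzagRow-step (m%n<n (j + r) n)) ⟩
        zigzagRow ((j + r) % n) + zigzag ((j + r) % n) + shift-back
                                                                ≡⟨ cong (λ x → zigzagRow ((j + r) % n) + x + shift-back) (Periodic-% zigzag-periodic (j + r)) ⟩
        zigzagRow ((j + r) % n) + zigzag (j + r) + shift-back   ≡⟨ shuffle _ (zigzag (j + r)) shift-back ⟩
        zigzagRow ((j + r) % n) + shift-back + zigzag (j + r)   ≈⟨ +-congʳ-≈ (zigzag (j + r)) (%-≈ (zigzagRow ((j + r) % n) + shift-back)) ⟨
        rotatedRow r j + zigzag (j + r)                         ∎
      where
        open ≈-Reasoning
        shuffle : ∀ a b c → a + b + c ≡ a + c + b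
        shuffle = solve-∀

    step-rotatedRow : ∀ j → step (rotatedRow r) j ≡ zigzag (j + r)
    step-rotatedRow j = ≈⇒step≡ {rotatedRow r} {j} rotatedRow<n (Allowed⇒<n (zigzag-allowed (j + r))) (rotatedRow-step j)

    rotatedRow-cyclic : CyclicRow (rotatedRow r)
    rotatedRow-cyclic = record
      { bounded = rotatedRow<n
      ; periodic = λ j → cong (λ x → (zigzagRow x + shift-back) % n)
                     (trans (cong (_% n) (trans (+-assoc j n r) (trans (cong (j +_) (+-comm n r)) (sym (+-assoc j r n))))) ([m+n]%n≡m%n (j + r) n))
      ; starts-at-0 = trans (cong (_% n) (m+[n∸m]≡n (<⇒≤ (zigzagRow<n (r % n))))) (n%n≡0 n)
      ; injective = λ {i} {j} i<j j<n same → ≉-within-period i<j (<-≤-trans j<n (m≤n+m n i)) (+-cancelʳ-≈ r (mk≈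
          (zigzagRow-injective (m%n<n (i + r) n) (m%n<n (j + r) n)
            (≈⇒≡ (zigzagRow<n ((i + r) % n)) (zigzagRow<n ((j + r) % n)) (+-cancelʳ-≈ shift-back (mk≈ same))))))
      ; allowed = λ j → subst Allowed (sym (step-rotatedRow j)) (zigzag-allowed (j + r))
      }

  Steep : ℕ → Set
  Steep c = c ≡ k ⊎ c ≡ suc m

  ≈bit*m⇒≡m : ∀ {d} → 0 < d → d < n → d ≈ bit (parity d) * m → d ≡ m × parity d ≡ 1ℙ
  ≈bit*m⇒≡m {d} 0<d d<n d≈ with parity d
  ... | 0ℙ = ⊥-elim (<⇒≢ 0<d (sym (≈⇒≡ d<n 0<n d≈)))
  ... | 1ℙ = ≈⇒≡ d<n m<n (≈-trans d≈ (≡⇒≈ (+-identityʳ m))) , refl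

  steep-multiple : ∀ {c d} → Steep c → d * c ≈ 0 → d ≈ bit (parity d) * m
  steep-multiple {d = d} (inj₁ refl) d*k≈0 = begin
      d                    ≡⟨ +-identityʳ d ⟨
      d + 0                ≈⟨ +-congˡ-≈ d d*k≈0 ⟨
      d + d * k            ≡⟨ *-suc d k ⟨
      d * m                ≈⟨ *m≈bit*m d ⟩
      bit (parity d) * m   ∎
    where open ≈-Reasoning
  steep-multiple {d = d} (inj₂ refl) d*[1+m]≈0 = +-cancelʳ-≈ (bit (parity d) * m) (begin
      d + b * m              ≈⟨ +-congˡ-≈ d (*m≈bit*m d) ⟨
      d + d * m              ≡⟨ *-suc d m ⟨
      d * suc m              ≈⟨ d*[1+m]≈0 ⟩
      0                      ≈⟨ cancel-bit (parity d) ⟨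
      b * m + b * m          ∎)
    where
      open ≈-Reasoning
      b = bit (parity d)
      cancel-bit : ∀ b → bit b * m + bit b * m ≈ 0
      cancel-bit 0ℙ = ≈-refl
      cancel-bit 1ℙ = ≈-trans (≡⇒≈ (trans (cong₂ _+_ (+-identityʳ m) (+-identityʳ m)) (sym n≡m+m))) n≈0

  steep-multiple≈0⇒odd : ∀ {c d} → Steep c → 0 < d → d < n → d * c ≈ 0 → parity m ≡ 1ℙ
  steep-multiple≈0⇒odd steep 0<d d<n d*c≈0 =
    let (d≡m , odd) = ≈bit*m⇒≡m 0<d d<n (steep-multiple steep d*c≈0) in subst (λ x → parity x ≡ 1ℙ) d≡m odd

  odd⇒m*steep≈0 : ∀ {c} → parity m ≡ 1ℙ → Steep c → m * c ≈ 0
  odd⇒m*steep≈0 odd (inj₁ refl) = +-cancelʳ-≈ m (begin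
      m * k + m        ≡⟨ trans (+-comm (m * k) m) (sym (*-suc m k)) ⟩
      m * m            ≈⟨ *m≈bit*m m ⟩
      bit (parity m) * m ≡⟨ cong (λ p → bit p * m) odd ⟩
      m + 0            ≡⟨ +-comm m 0 ⟩
      0 + m            ∎)
    where open ≈-Reasoning
  odd⇒m*steep≈0 odd (inj₂ refl) = begin
      m * suc m        ≡⟨ *-suc m m ⟩
      m + m * m        ≈⟨ +-congˡ-≈ m (*m≈bit*m m) ⟩
      m + bit (parity m) * m ≡⟨ cong (λ p → m + bit p * m) odd ⟩
      m + (m + 0)      ≡⟨ trans (cong (m +_) (+-identityʳ m)) (sym n≡m+m) ⟩
      n                ≈⟨ n≈0 ⟩
      0                ∎
    where open ≈-Reasoning

  Steep⇒Allowed : ∀ {c} → Steep c → Allowed c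
  Steep⇒Allowed (inj₁ c≡k) = inj₁ c≡k
  Steep⇒Allowed (inj₂ c≡1+m) = inj₂ (inj₂ c≡1+m)

  constantRow : ℕ → ℕ → ℕ
  constantRow c j = (j * c) % n

  module _ {c : ℕ} (steep : Steep c) where
    private
      c<n = Allowed⇒<n (Steep⇒Allowed steep)

    constantRow-step : ∀ j → constantRow c (suc j) ≈ constantRow c j + c
    constantRow-step j = ≈-trans (%-≈ (c + j * c)) (≈-trans (≡⇒≈ (+-comm c (j * c))) (+-congʳ-≈ c (≈-sym (%-≈ (j * c)))))

    step-constantRow : ∀ j → step (constantRow c) j ≡ c
    step-constantRow j = ≈⇒step≡ {constantRow c} {j} (λ j → m%n<n (j * c) n) c<n (constantRow-step j)

    constantRow-cyclic : parity m ≡ 0ℙ → CyclicRow (constantRow c)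
    constantRow-cyclic even = record
      { bounded = λ j → m%n<n (j * c) n
      ; periodic = λ j → trans (cong (_% n) (trans (*-distribʳ-+ c j n) (cong (j * c +_) (*-comm n c)))) ([m+kn]%n≡m%n (j * c) c n)
      ; starts-at-0 = refl
      ; injective = λ {i} {j} i<j j<n same → ℙ.p≢p⁻¹ 0ℙ (trans (sym even)
          (steep-multiple≈0⇒odd steep (m<n⇒0<n∸m i<j) (≤-<-trans (m∸n≤m j i) j<n) (difference≈0 i<j same)))
      ; allowed = λ j → subst Allowed (sym (step-constantRow j)) (Steep⇒Allowed steep)
      }
      where
        difference≈0 : ∀ {i j} → i < j → constantRow c i ≡ constantRow c j → (j ∸ i) * c ≈ 0
        difference≈0 {i} {j} i<j same = +-cancelˡ-≈ (i * c) (begin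
            i * c + (j ∸ i) * c    ≡⟨ *-distribʳ-+ c i (j ∸ i) ⟨
            (i + (j ∸ i)) * c      ≡⟨ cong (_* c) (m+[n∸m]≡n (<⇒≤ i<j)) ⟩
            j * c                  ≈⟨ mk≈ same ⟨
            i * c                  ≡⟨ +-identityʳ (i * c) ⟨
            i * c + 0              ∎)
          where open ≈-Reasoning

  no-constant-row : ∀ {F c} → CyclicRow F → (∀ j → step F j ≡ c) → m * c ≈ 0 → ⊥
  no-constant-row {F} {c} row constant m*c≈0 =
    injective z<s m<n (trans starts-at-0 (sym (≈⇒≡ (bounded m) 0<n (≈-trans (F≈j*c m) m*c≈0))))
    where
      open CyclicRow row
      F≈j*c : ∀ j → F j ≈ j * c
      F≈j*c zero = ≡⇒≈ starts-at-0
      F≈j*c (suc j) = begin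
        F (suc j)       ≈⟨ step-correct j ⟩
        F j + step F j  ≈⟨ +-cong-≈ (F≈j*c j) (≡⇒≈ (constant j)) ⟩
        j * c + c       ≡⟨ +-comm (j * c) c ⟩
        suc j * c       ∎
        where open ≈-Reasoning

  4∣n⇒even : 4 ∣ n → parity m ≡ 0ℙ
  4∣n⇒even (divides q n≡q*4) = trans (cong parity (*-cancelʳ-≡ m (q + q) 2 (trans n≡q*4 (regroup q)))) (parity-double q)
    where
      regroup : ∀ q → q * 4 ≡ (q + q) * 2
      regroup = solve-∀

  ¬4∣n⇒odd : ¬ 4 ∣ n → parity m ≡ 1ℙ
  ¬4∣n⇒odd ¬4∣n with parity m in eq
  ... | 1ℙ = refl
  ... | 0ℙ = ⊥-elim (¬4∣n (divides ⌊ m /2⌋ (trans (cong (_* 2) (trans (halves m) (cong (λ p → ⌊ m /2⌋ + ⌊ m /2⌋ + bit p) eq))) (regroup ⌊ m /2⌋))))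
    where
      regroup : ∀ q → (q + q + 0) * 2 ≡ q * 4
      regroup = solve-∀

  steps-determine-row : ∀ {F G} → CyclicRow F → CyclicRow G → (∀ j → step F j ≡ step G j) → ∀ j → F j ≡ G j
  steps-determine-row F-row G-row same zero = trans (CyclicRow.starts-at-0 F-row) (sym (CyclicRow.starts-at-0 G-row))
  steps-determine-row {F} {G} F-row G-row same (suc j) = ≈⇒≡ (CyclicRow.bounded F-row (suc j)) (CyclicRow.bounded G-row (suc j)) (begin
      F (suc j)        ≈⟨ CyclicRow.step-correct F-row j ⟩
      F j + step F j   ≡⟨ cong₂ _+_ (steps-determine-row F-row G-row same j) (same j) ⟩
      G j + step G j   ≈⟨ CyclicRow.step-correct G-row j ⟨
      G (suc j)        ∎)
    where open ≈-Reasoning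

  rowFunction-injective : ∀ {s s′} → (∀ {j} → j < n → rowFunction s j ≡ rowFunction s′ j) → s ≡ s′
  rowFunction-injective {s} {s′} same = lookupOr-ext s s′ 0F λ {j} j<n →
    toℕ-injective (trans (cong (toℕ ∘ lookupOr s 0F) (sym (m<n⇒m%n≡m j<n)))
                  (trans (same j<n) (cong (toℕ ∘ lookupOr s′ 0F) (m<n⇒m%n≡m j<n))))

  row≡rowOf : ∀ {s G} → NormalCyclicMaxRow n s → CyclicRow G → (∀ j → step (rowFunction s) j ≡ step G j) → s ≡ rowOf G
  row≡rowOf {s} valid G-row same = rowFunction-injective λ {j} _ →
    trans (steps-determine-row (rowFunction-cyclicRow s valid) G-row same j) (sym (rowFunction-rowOf G-row j))

  rowOf-steps : ∀ {F G} → CyclicRow F → CyclicRow G → rowOf F ≡ rowOf G → ∀ j → step F j ≡ step G j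
  rowOf-steps {F} {G} F-row G-row same j = cong₂ (resDiff n) (F≡G (suc j)) (F≡G j)
    where
      F≡G : ∀ i → F i ≡ G i
      F≡G i = trans (sym (rowFunction-rowOf F-row i)) (trans (cong (λ s → rowFunction s i) same) (rowFunction-rowOf G-row i))

  -- The extended difference row

  ε : ℕ → ℤ
  ε h = ℤ.+ h ℤ.- ℤ.+ m

  1+x⊖x≡1 : ∀ x → suc x ℤ.⊖ x ≡ ℤ.+ 1
  1+x⊖x≡1 zero = refl
  1+x⊖x≡1 (suc x) = trans (ℤP.[1+m]⊖[1+n]≡m⊖n (suc x) x) (1+x⊖x≡1 x)

  ε-up : ε (suc m) ≡ ℤ.+ 1
  ε-up = trans (ℤP.[+m]-[+n]≡m⊖n (suc m) m) (1+x⊖x≡1 m)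

  ε-flat : ε m ≡ ℤ.+ 0
  ε-flat = trans (ℤP.[+m]-[+n]≡m⊖n m m) (ℤP.n⊖n≡0 m)

  ε-down : ε k ≡ ℤ.- ℤ.+ 1
  ε-down = trans (ℤP.[+m]-[+n]≡m⊖n k m) (trans (ℤP.⊖-swap k m) (cong ℤ.-_ (1+x⊖x≡1 k)))

  pattern₀≡zigzag : pattern₀ n ≡ applyUpTo (ε ∘ zigzag) n
  pattern₀≡zigzag = begin
      pattern₀ n
    ≡⟨ cong (λ h → replicate (h ∸ 1) (ℤ.+ 1) ++ [ ℤ.+ 0 ] ++ replicate (h ∸ 1) (ℤ.- ℤ.+ 1) ++ [ ℤ.+ 0 ]) n/2≡m ⟩
      replicate k (ℤ.+ 1) ++ ℤ.+ 0 ∷ replicate k (ℤ.- ℤ.+ 1) ++ [ ℤ.+ 0 ]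
    ≡⟨ cong₂ _++_ rising (cong₂ _∷_ peak (cong₂ _++_ falling (cong [_] valley))) ⟩
      applyUpTo Z k ++ Z (k + 0) ∷ applyUpTo (λ j → Z (k + suc j)) k ++ [ Z (k + suc (k + 0)) ]
    ≡⟨ cong (λ xs → applyUpTo Z k ++ Z (k + 0) ∷ xs) (applyUpTo-++ (λ j → Z (k + suc j)) k 1) ⟨
      applyUpTo Z k ++ applyUpTo (λ j → Z (k + j)) (suc (k + 1))
    ≡⟨ applyUpTo-++ Z k (suc (k + 1)) ⟨
      applyUpTo Z (k + suc (k + 1))
    ≡⟨ cong (applyUpTo Z) n≡k+[1+k+1] ⟨
      applyUpTo Z n
    ∎
    where
      open ≡-Reasoning
      Z = ε ∘ zigzag
      n≡k+[1+k+1] : n ≡ k + suc (k + 1)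
      n≡k+[1+k+1] = trans n≡2+2k (identity k)
        where
          identity : ∀ k → suc (suc (k + k)) ≡ k + suc (k + 1)
          identity = solve-∀
      rising : replicate k (ℤ.+ 1) ≡ applyUpTo Z k
      rising = trans (replicate-applyUpTo _ k) (applyUpTo-cong k (λ j<k → sym (trans (cong ε (zigzag-rising j<k)) ε-up)))
      peak : ℤ.+ 0 ≡ Z (k + 0)
      peak = sym (trans (cong (ε ∘ zigzag) (+-identityʳ k)) (trans (cong ε zigzag-peak) ε-flat))
      falling : replicate k (ℤ.- ℤ.+ 1) ≡ applyUpTo (λ j → Z (k + suc j)) k
      falling = trans (replicate-applyUpTo _ k) (applyUpTo-cong k (λ j<k →
        sym (trans (cong ε (zigzag-falling (m<m+n k z<s) (s≤s (+-monoʳ-≤ k j<k)))) ε-down)))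
      valley : ℤ.+ 0 ≡ Z (k + suc (k + 0))
      valley = sym (trans (cong (ε ∘ zigzag) (trans (+-suc k (k + 0)) (cong (suc ∘ (k +_)) (+-identityʳ k))))
                          (trans (cong ε zigzag-valley) ε-flat))

  extDiffRow-shape : ∀ s → NormalCyclicMaxRow n s →
    IsRotationOf (extDiffRow n s) (pattern₀ n) ⊎ extDiffRow n s ≡ replicate n (ℤ.+ 1) ⊎ extDiffRow n s ≡ replicate n (ℤ.- ℤ.+ 1)
  extDiffRow-shape s valid with Classification.classify (rowFunction-cyclicRow s valid)
  ... | zigzagging r r<n agree = inj₁ (r , (begin
      extDiffRow n s                                    ≡⟨ extDiffRow-steps s ⟩
      applyUpTo (ε ∘ step (rowFunction s)) n            ≡⟨ applyUpTo-cong n (λ {j} _ → cong ε (agree j)) ⟩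
      applyUpTo (λ j → ε (zigzag (j + r))) n            ≡⟨ rotate-periodic (cong ε ∘ zigzag-periodic) (<⇒≤ r<n) ⟨
      drop r (applyUpTo Z n) ++ take r (applyUpTo Z n)  ≡⟨ cong (λ xs → drop r xs ++ take r xs) pattern₀≡zigzag ⟨
      drop r (pattern₀ n) ++ take r (pattern₀ n)        ∎))
    where
      open ≡-Reasoning
      Z = ε ∘ zigzag
  ... | ascending up = inj₂ (inj₁ (trans (extDiffRow-steps s)
          (trans (applyUpTo-cong n (λ {j} _ → trans (cong ε (up j)) ε-up)) (sym (replicate-applyUpTo _ n)))))
  ... | descending down = inj₂ (inj₂ (trans (extDiffRow-steps s)
          (trans (applyUpTo-cong n (λ {j} _ → trans (cong ε (down j)) ε-down)) (sym (replicate-applyUpTo _ n)))))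

  -- Counting the rows

  zigzag-valley-unique : ∀ u → zigzag u ≡ m → zigzag (suc u) ≡ suc m → u ≈ suc (k + k)
  zigzag-valley-unique u flat up with zigzag≡m⇒turningPoint (m%n<n u n) (trans (Periodic-% zigzag-periodic u) flat)
  ... | inj₂ u%n≡1+2k = ≈-trans (≈-sym (%-≈ u)) (≡⇒≈ u%n≡1+2k)
  ... | inj₁ u%n≡k = ⊥-elim (<-irrefl (trans (sym (zigzag-falling (n<1+n k) (s≤s (m<m+n k 0<k)))) down) (<-trans (n<1+n k) (n<1+n m)))
    where
      0<k : 0 < k
      0<k = ≤-trans (s≤s z≤n) 2≤k
      down : zigzag (suc k) ≡ suc m
      down = trans (Periodic-≈ zigzag-periodic (+-congˡ-≈ 1 (≈-trans (≡⇒≈ (sym u%n≡k)) (%-≈ u)))) up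

  zigzag-shift-injective : ∀ {r r′} → r < n → r′ < n → (∀ x → zigzag (x + r) ≡ zigzag (x + r′)) → r ≡ r′
  zigzag-shift-injective {r} {r′} r<n r′<n same = ≈⇒≡ r<n r′<n (+-cancelˡ-≈ x (≈-trans (≡⇒≈ x+r≡) (≈-trans (+n≈ (suc (k + k))) (≈-sym valley′))))
    where
      x = suc (k + k) + (n ∸ r)
      x+r≡ : x + r ≡ suc (k + k) + n
      x+r≡ = trans (+-assoc (suc (k + k)) (n ∸ r) r) (cong (suc (k + k) +_) (m∸n+n≡m (<⇒≤ r<n)))
      valley : zigzag (x + r) ≡ m
      valley = trans (cong zigzag x+r≡) (trans (zigzag-periodic (suc (k + k))) zigzag-valley)
      rise : zigzag (suc x + r) ≡ suc m
      rise = trans (cong zigzag (trans (cong suc x+r≡) (cong (_+ n) (sym n≡2+2k))))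
               (trans (zigzag-periodic n) (trans (Periodic-≈ zigzag-periodic n≈0) (zigzag-rising (≤-trans (s≤s z≤n) 2≤k))))
      valley′ : x + r′ ≈ suc (k + k)
      valley′ = zigzag-valley-unique (x + r′) (trans (sym (same x)) valley) (trans (sym (same (suc x))) rise)

  rotationRow : ℕ → Vec (Fin n) n
  rotationRow r = rowOf (rotatedRow r)

  zigzagRows : List (Vec (Fin n) n)
  zigzagRows = applyUpTo rotationRow n

  zigzagRows-unique : Unique zigzagRows
  zigzagRows-unique = Unique.applyUpTo⁺₁ rotationRow n λ {i} {j} i<j j<n same →
    <⇒≢ i<j (zigzag-shift-injective (<-trans i<j j<n) j<n λ x →
      trans (sym (step-rotatedRow i x)) (trans (rowOf-steps (rotatedRow-cyclic i) (rotatedRow-cyclic j) same x) (step-rotatedRow j x)))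

  ∈zigzagRows⇒valid : ∀ {s} → s ∈ zigzagRows → NormalCyclicMaxRow n s
  ∈zigzagRows⇒valid s∈ with ∈-applyUpTo⁻ rotationRow s∈
  ... | r , _ , refl = rowOf-valid (rotatedRow-cyclic r)

  zigzagging⇒∈zigzagRows : ∀ {s r} → NormalCyclicMaxRow n s → r < n →
    (∀ j → step (rowFunction s) j ≡ zigzag (j + r)) → s ∈ zigzagRows
  zigzagging⇒∈zigzagRows {s} {r} valid r<n agree =
    subst (_∈ zigzagRows) (sym (row≡rowOf valid (rotatedRow-cyclic r) (λ j → trans (agree j) (sym (step-rotatedRow r j)))))
          (∈-applyUpTo⁺ rotationRow r<n)

  constant∉zigzagRows : ∀ {F c} → CyclicRow F → (∀ j → step F j ≡ c) → c ≢ m → ¬ (rowOf F ∈ zigzagRows)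
  constant∉zigzagRows {F} {c} row constant c≢m F∈ with ∈-applyUpTo⁻ rotationRow F∈
  ... | r , r<n , same = c≢m (begin
      c                                     ≡⟨ constant x ⟨
      step F x                              ≡⟨ rowOf-steps row (rotatedRow-cyclic r) same x ⟩
      step (rotatedRow r) x                 ≡⟨ step-rotatedRow r x ⟩
      zigzag (x + r)                        ≡⟨ cong zigzag (trans (+-assoc (suc (k + k)) (n ∸ r) r) (cong (suc (k + k) +_) (m∸n+n≡m (<⇒≤ r<n)))) ⟩
      zigzag (suc (k + k) + n)              ≡⟨ zigzag-periodic (suc (k + k)) ⟩
      zigzag (suc (k + k))                  ≡⟨ zigzag-valley ⟩
      m                                     ∎)
    where
      open ≡-Reasoning
      x = suc (k + k) + (n ∸ r)

  classify-row : ∀ {s} → NormalCyclicMaxRow n s → Shape (step (rowFunction s))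
  classify-row {s} valid = Classification.classify (rowFunction-cyclicRow s valid)

  count-when-4∣n : 4 ∣ n → HasExactlyRows n (n + 2)
  count-when-4∣n 4∣n = rows , unique , length≡ , λ s → complete s , sound
    where
      even = 4∣n⇒even 4∣n
      up-row = constantRow-cyclic (inj₂ refl) even
      down-row = constantRow-cyclic (inj₁ refl) even
      up = rowOf (constantRow (suc m))
      down = rowOf (constantRow k)
      rows = zigzagRows ++ up ∷ down ∷ []
      up≢down : up ≢ down
      up≢down same = <-irrefl (trans (sym (step-constantRow (inj₁ refl) 0))
                      (trans (sym (rowOf-steps up-row down-row same 0)) (step-constantRow (inj₂ refl) 0))) (<-trans (n<1+n k) (n<1+n m))
      unique : Unique rows
      unique = Unique.++⁺ zigzagRows-unique ((up≢down ∷ []) ∷ [] ∷ []) λ where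
        (s∈ , here refl) → constant∉zigzagRows up-row (step-constantRow (inj₂ refl)) (λ e → <-irrefl (sym e) (n<1+n m)) s∈
        (s∈ , there (here refl)) → constant∉zigzagRows down-row (step-constantRow (inj₁ refl)) (λ e → <-irrefl e (n<1+n k)) s∈
      length≡ : length rows ≡ n + 2
      length≡ = trans (length-++ zigzagRows) (cong (_+ 2) (length-applyUpTo rotationRow n))
      complete : ∀ s → NormalCyclicMaxRow n s → s ∈ rows
      complete s valid with classify-row valid
      ... | zigzagging r r<n agree = ∈-++⁺ˡ (zigzagging⇒∈zigzagRows valid r<n agree)
      ... | ascending all-up = ∈-++⁺ʳ zigzagRows (here (row≡rowOf valid up-row λ j → trans (all-up j) (sym (step-constantRow (inj₂ refl) j))))
      ... | descending all-down = ∈-++⁺ʳ zigzagRows (there (here (row≡rowOf valid down-row λ j → trans (all-down j) (sym (step-constantRow (inj₁ refl) j)))))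
      sound : ∀ {s} → s ∈ rows → NormalCyclicMaxRow n s
      sound s∈ with ∈-++⁻ zigzagRows s∈
      ... | inj₁ s∈zigzag = ∈zigzagRows⇒valid s∈zigzag
      ... | inj₂ (here refl) = rowOf-valid up-row
      ... | inj₂ (there (here refl)) = rowOf-valid down-row

  count-when-¬4∣n : ¬ 4 ∣ n → HasExactlyRows n n
  count-when-¬4∣n ¬4∣n = zigzagRows , zigzagRows-unique , length-applyUpTo rotationRow n , λ s → complete s , ∈zigzagRows⇒valid
    where
      odd = ¬4∣n⇒odd ¬4∣n
      complete : ∀ s → NormalCyclicMaxRow n s → s ∈ zigzagRows
      complete s valid with classify-row valid
      ... | zigzagging r r<n agree = zigzagging⇒∈zigzagRows valid r<n agree
      ... | ascending all-up = ⊥-elim (no-constant-row (rowFunction-cyclicRow s valid) all-up (odd⇒m*steep≈0 odd (inj₂ refl)))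
      ... | descending all-down = ⊥-elim (no-constant-row (rowFunction-cyclicRow s valid) all-down (odd⇒m*steep≈0 odd (inj₁ refl)))

mainTheorem4 : (n : ℕ) → 6 ≤ n → 2 ∣ n →
    ((s : Vec (Fin n) n) → NormalCyclicMaxRow n s →
      IsRotationOf (extDiffRow n s) (pattern₀ n)
      ⊎ extDiffRow n s ≡ replicate n (ℤ.+ 1)
      ⊎ extDiffRow n s ≡ replicate n (ℤ.- ℤ.+ 1))
    × (4 ∣ n → HasExactlyRows n (n + 2))
    × (¬ 4 ∣ n → HasExactlyRows n n)
mainTheorem4 _ () (divides 0 refl)
mainTheorem4 _ (s≤s (s≤s ())) (divides 1 refl)
mainTheorem4 _ (s≤s (s≤s (s≤s (s≤s ())))) (divides 2 refl)
mainTheorem4 _ _ (divides (suc (suc (suc k))) refl) = extDiffRow-shape , count-when-4∣n , count-when-¬4∣n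
  where open EvenLength (suc (suc k)) (s≤s (s≤s z≤n))
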